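{- Let $\ell\ge1$ and let $\mathcal{A}=\mathcal{A}(A_\ell)$ be the Coxeter arrangement of type $A_\ell$ with the symmetric group $\mathfrak{S}_{\ell+1}$ acting on the coweight lattice $Z$. For each $\sigma\in\mathfrak{S}_{\ell+1}$ and $q\in\mathbb{Z}_{>0}$, $$\chi_{\mathcal{A},q}(\sigma)=\begin{cases}\varphi_g(\ell+1)\,(q-d)(q-2d)\cdots(q-d(g-1)) & \text{if } q\in d\mathbb{Z} \text{ and } \sigma \text{ has cycle type } (d,\dots,d),\\ 0&\text{otherwise,}\end{cases}$$ where $g,d$ are divisors of $\ell+1$ with $gd=\ell+1$. Hence $q\mapsto\chi_{\mathcal{A},q}$ has minimum period $\ell+1$.
   Context: $E=\{x\in\mathbb{R}^{\ell+1}:x_1+\dots+x_{\ell+1}=0\}$ with the standard inner product; $\Phi=\{e_i-e_j:i\ne j\}$; $Z=\{x\in E:(e_i-e_j,x)\in\mathbb{Z}\ \forall i,j\}$. $\mathfrak{S}_{\ell+1}$ acts by $e_i\mapsto e_{\sigma(i)}$. $\mathcal{A}=\{H_{ij}:1\le i<j\le\ell+1\}$, $H_{ij}=\{x\in E:(e_i-e_j,x)=0\}$. $M(\mathcal{A};q)=\{x+qZ\in Z/qZ:(e_i-e_j,x)\not\equiv0\pmod q\ \forall i<j\}$ and $\chi_{\mathcal{A},q}(\sigma)$ is the number of elements of $M(\mathcal{A};q)$ fixed by $\sigma$. The cycle type $(d,\dots,d)$ means $\sigma$ is a product of $g$ disjoint $d$-cycles. $\varphi_g(\ell+1)=\#\{i\in\{1,\dots,\ell+1\}:\gcd\{\ell+1,i\}=g\}$.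 A period of a class-function-valued function $F$ of $q$ is a positive integer $\tilde n$ such that $F$ is given by a polynomial in $q$ on each residue class mod $\tilde n$. -}

module Defs where

open import Data.Nat as ℕ using (ℕ; zero; suc; _<_; _∸_)
import Data.Nat.Divisibility as ℕD
open import Data.Nat.GCD using (gcd)
open import Data.Integer as ℤ using (ℤ; +_)
open import Data.Integer.Divisibility using (_∣_)
open import Data.Rational as ℚ using (ℚ)
open import Data.Fin using (Fin; toℕ)
open import Data.Fin.Properties using (all?)
open import Data.Fin.Permutation using (Permutation′; _⟨$⟩ʳ_; _⟨$⟩ˡ_)
open import Data.List using (List; []; _∷_; map; filter; length; concatMap; upTo; foldr)
open import Data.Product using (_×_; Σ)
open import Relation.Binary.PropositionalEquality using (_≡_; _≢_)
open import Relation.Nullary using (¬_; Dec)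
open import Relation.Nullary.Decidable using (¬?; _→-dec_)
open import Function using (_∘_)

_≡_[mod_] : ℕ → ℕ → ℕ → Set
a ≡ b [mod q ] = (+ q) ∣ ((+ a) ℤ.- (+ b))

_≡?_[mod_] : (a b q : ℕ) → Dec (a ≡ b [mod q ])
a ≡? b [mod q ] = q ℕD.∣? ℤ.∣ (+ a) ℤ.- (+ b) ∣

-- Z / qZ for the coweight lattice Z of type A_ℓ, n = ℓ + 1 coordinates.
-- A class x + qZ is encoded by the residues a_i ≡ (e_i - e_1 , x) mod q,
-- i = 1..n (so a_1 = 0); this is a bijection Z/qZ ≅ (ℤ/q)^ℓ.
-- A point is given by (a_2,…,a_n) : Fin ℓ → Fin q.

Point : ℕ → ℕ → Set
Point ℓ q = Fin ℓ → Fin q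

allFuns : (k q : ℕ) → List (Fin k → Fin q)
allFuns zero    q = (λ ()) ∷ []
allFuns (suc k) q =
  concatMap (λ f → map (λ c → λ { Fin.zero → c ; (Fin.suc i) → f i }) (Data.List.allFin q))
            (allFuns k q)
  where import Data.Fin as Fin; import Data.List

coord : ∀ {ℓ q} → Point ℓ q → Fin (suc ℓ) → ℕ
coord a Fin.zero    = 0
  where import Data.Fin as Fin
coord a (Fin.suc i) = toℕ (a i)
  where import Data.Fin as Fin

-- x + qZ ∈ M(A;q):  (e_i - e_j , x) = a_i - a_j ≢ 0 (mod q) for all i ≠ j
InM : ∀ {ℓ q} → Point ℓ q → Set
InM {ℓ} {q} a = ∀ (i j : Fin (suc ℓ)) → i ≢ j → ¬ (coord a i ≡ coord a j [mod q ])

-- σ fixes x + qZ: (e_k - e_1 , σx) ≡ (e_k - e_1 , x) mod q for all k,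
-- where (e_k - e_1 , σx) = (e_{σ⁻¹k} - e_{σ⁻¹1} , x) = a_{σ⁻¹k} - a_{σ⁻¹1};
-- i.e. a_{σ⁻¹k} ≡ a_k + a_{σ⁻¹1} (mod q).
Fixed : ∀ {ℓ q} → Permutation′ (suc ℓ) → Point ℓ q → Set
Fixed {ℓ} {q} σ a = ∀ (k : Fin (suc ℓ)) →
  coord a (σ ⟨$⟩ˡ k) ≡ (coord a k ℕ.+ coord a (σ ⟨$⟩ˡ Data.Fin.zero)) [mod q ]

InM? : ∀ {ℓ q} (a : Point ℓ q) → Dec (InM a)
InM? {ℓ} {q} a = all? λ i → all? λ j →
  ¬? (i Data.Fin.≟ j) →-dec ¬? (coord a i ≡? coord a j [mod q ])
  where import Data.Fin

Fixed? : ∀ {ℓ q} (σ : Permutation′ (suc ℓ)) (a : Point ℓ q) → Dec (Fixed σ a)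
Fixed? {ℓ} {q} σ a = all? λ k →
  coord a (σ ⟨$⟩ˡ k) ≡? (coord a k ℕ.+ coord a (σ ⟨$⟩ˡ Data.Fin.zero)) [mod q ]

χ : (ℓ q : ℕ) → Permutation′ (suc ℓ) → ℕ
χ ℓ q σ = length (filter (λ a → Fixed? σ a) (filter InM? (allFuns ℓ q)))

iter : ∀ {n} → Permutation′ n → ℕ → Fin n → Fin n
iter σ zero    i = i
iter σ (suc k) i = σ ⟨$⟩ʳ (iter σ k i)

CycleType : ∀ {n} → ℕ → Permutation′ n → Set
CycleType {n} d σ = ∀ (i : Fin n) →
  (iter σ d i ≡ i) × (∀ k → 0 < k → k < d → iter σ k i ≢ i)

φ : ℕ → ℕ → ℕ
φ g m = length (filter (λ i → gcd m i ℕ.≟ g) (map suc (upTo m)))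

fallProd : ℕ → ℕ → ℕ → ℤ
fallProd q d zero    = + 1
fallProd q d (suc k) = fallProd q d k ℤ.* ((+ q) ℤ.- (+ (suc k ℕ.* d)))

evalPoly : List ℚ → ℕ → ℚ
evalPoly cs q = foldr (λ c acc → c ℚ.+ ((+ q) ℚ./ 1) ℚ.* acc) ℚ.0ℚ cs

IsPeriod : ℕ → ℕ → Set
IsPeriod ℓ p = 0 < p × (∀ (r : ℕ) → Σ (Permutation′ (suc ℓ) → List ℚ) λ P →
  ∀ (q : ℕ) → 0 < q → q ≡ r [mod p ] → ∀ σ → ((+ χ ℓ q σ) ℚ./ 1) ≡ evalPoly (P σ) q)

{-# OPTIONS --safe #-}
module Submission where

-- A point x + qZ is recorded by its coordinates a_i = (e_i - e_1, x) mod q, so that a_1 = 0.  It is fixed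
-- by σ iff σ shifts every coordinate by the same c = a_σ(1), i.e. along each cycle of σ the coordinates form
-- an arithmetic progression with difference c.  For x ∈ M(A;q) the coordinates are pairwise distinct, so
-- every cycle has length the additive order d of c modulo q, and d ∣ q; without such a cycle type χ vanishes.
-- Conversely, if σ has cycle type (d,…,d) with g cycles and q = d m, a fixed point in M(A;q) amounts to
-- c = m u with u a unit modulo d, together with a starting coordinate for each of the g - 1 cycles not
-- containing 1, these having distinct non-zero residues modulo m.  There are φ_g(ℓ+1) units, via
-- u ↦ g (d - u), and d(m - 1) d(m - 2) ⋯ d(m - g + 1) = (q - d)(q - 2d) ⋯ (q - (g - 1)d) starting coordinates.
-- Whether d ∣ q depends only on q mod ℓ+1, which gives the period ℓ+1.  For an (ℓ+1)-cycle, χ vanishes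
-- unless ℓ+1 ∣ q and equals φ_1(ℓ+1) > 0 otherwise; since a polynomial with infinitely many zeros is zero,
-- no smaller period exists.

open import Defs

module Polynomials where

  open import Data.Nat as ℕ using (ℕ; zero; suc; _≤_; s≤s)
  open import Data.Nat.GCD using (gcd-zeroʳ)
  open import Data.Integer as ℤ using (ℤ)
  import Data.Integer.Properties as ℤ
  import Data.Integer.GCD as ℤ
  open import Data.Rational as ℚ using (ℚ; ↥_; ↧_; ↧ₙ_; 0ℚ; 1ℚ; _+_; _*_; _-_; -_; _/_)
  open import Data.Rational.Properties as ℚ using (+-*-commutativeRing; ↥-/; ↧-/; ↥p/↧p≡p; ↥-neg; ↧-neg; /-cong; ↥p≡0⇒p≡0)
  open import Tactic.RingSolver using (solve-∀)
  open import Tactic.RingSolver.Core.AlmostCommutativeRing using (AlmostCommutativeRing; fromCommutativeRing)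
  open import Relation.Nullary.Decidable using (dec⇒maybe)
  open import Data.List using (List; []; _∷_; length; map)
  open import Data.List.Relation.Unary.All as All using (All; []; _∷_)
  open import Data.List.Relation.Unary.AllPairs using ([]; _∷_)
  open import Data.List.Relation.Unary.Unique.Propositional using (Unique)
  open import Relation.Binary.PropositionalEquality
  open import Function using (_∘_)
  open import Level using (0ℓ)

  ℚ-ring : AlmostCommutativeRing 0ℓ 0ℓ
  ℚ-ring = fromCommutativeRing +-*-commutativeRing (λ x → dec⇒maybe (0ℚ ℚ.≟ x))

  toℚ : ℤ → ℚ
  toℚ i = i / 1

  ℕ→ℚ : ℕ → ℚ
  ℕ→ℚ n = toℚ (ℤ.+ n)

  private
    gcd[i,1]≡1 : ∀ i → ℤ.gcd i (ℤ.+ 1) ≡ ℤ.+ 1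
    gcd[i,1]≡1 i = cong ℤ.+_ (gcd-zeroʳ ℤ.∣ i ∣)

  ↥-toℚ : ∀ i → ↥ toℚ i ≡ i
  ↥-toℚ i = trans (sym (ℤ.*-identityʳ (↥ toℚ i))) (trans (cong (↥ toℚ i ℤ.*_) (sym (gcd[i,1]≡1 i))) (↥-/ i 1))

  ↧ₙ-toℚ : ∀ i → ↧ₙ toℚ i ≡ 1
  ↧ₙ-toℚ i = ℤ.+-injective (trans (sym (ℤ.*-identityʳ (↧ toℚ i))) (trans (cong (↧ toℚ i ℤ.*_) (sym (gcd[i,1]≡1 i))) (↧-/ i 1)))

  toℚ-injective : ∀ {i j} → toℚ i ≡ toℚ j → i ≡ j
  toℚ-injective {i} {j} eq = trans (sym (↥-toℚ i)) (trans (cong ↥_ eq) (↥-toℚ j))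

  toℚ-* : ∀ i j → toℚ (i ℤ.* j) ≡ toℚ i * toℚ j
  toℚ-* i j = sym (trans (*-defn (toℚ i) (toℚ j)) (/-cong (cong₂ ℤ._*_ (↥-toℚ i) (↥-toℚ j)) (cong₂ ℕ._*_ (↧ₙ-toℚ i) (↧ₙ-toℚ j))))
    where
    *-defn : ∀ p r → p * r ≡ (↥ p ℤ.* ↥ r) / (↧ₙ p ℕ.* ↧ₙ r)
    *-defn p@record{} r@record{} = refl

  toℚ-+ : ∀ i j → toℚ (i ℤ.+ j) ≡ toℚ i + toℚ j
  toℚ-+ i j = sym (trans (+-defn (toℚ i) (toℚ j)) (/-cong numerator (cong₂ ℕ._*_ (↧ₙ-toℚ i) (↧ₙ-toℚ j))))
    where
    +-defn : ∀ p r → p + r ≡ (↥ p ℤ.* ↧ r ℤ.+ ↥ r ℤ.* ↧ p) / (↧ₙ p ℕ.* ↧ₙ r)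
    +-defn p@record{} r@record{} = refl
    numerator : ↥ toℚ i ℤ.* ↧ toℚ j ℤ.+ ↥ toℚ j ℤ.* ↧ toℚ i ≡ i ℤ.+ j
    numerator = trans (cong₂ ℤ._+_ (cong₂ ℤ._*_ (↥-toℚ i) (cong ℤ.+_ (↧ₙ-toℚ j))) (cong₂ ℤ._*_ (↥-toℚ j) (cong ℤ.+_ (↧ₙ-toℚ i))))
                      (cong₂ ℤ._+_ (ℤ.*-identityʳ i) (ℤ.*-identityʳ j))

  toℚ-neg : ∀ i → toℚ (ℤ.- i) ≡ - toℚ i
  toℚ-neg i = trans (/-cong (sym (trans (↥-neg (toℚ i)) (cong ℤ.-_ (↥-toℚ i)))) (sym (trans (ℤ.+-injective (↧-neg (toℚ i))) (↧ₙ-toℚ i))))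
                    (↥p/↧p≡p (- toℚ i))

  toℚ-- : ∀ i j → toℚ (i ℤ.- j) ≡ toℚ i - toℚ j
  toℚ-- i j = trans (toℚ-+ i (ℤ.- j)) (cong (λ r → toℚ i + r) (toℚ-neg j))

  infixl 6 _⊕_
  _⊕_ : List ℚ → List ℚ → List ℚ
  [] ⊕ ys = ys
  (x ∷ xs) ⊕ [] = x ∷ xs
  (x ∷ xs) ⊕ (y ∷ ys) = (x + y) ∷ (xs ⊕ ys)

  evalPoly-⊕ : ∀ xs ys q → evalPoly (xs ⊕ ys) q ≡ evalPoly xs q + evalPoly ys q
  evalPoly-⊕ [] ys q = sym (ℚ.+-identityˡ _)
  evalPoly-⊕ (x ∷ xs) [] q = sym (ℚ.+-identityʳ _)
  evalPoly-⊕ (x ∷ xs) (y ∷ ys) q = trans (cong (λ e → (x + y) + ℕ→ℚ q * e) (evalPoly-⊕ xs ys q))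
    (interchange x y (ℕ→ℚ q) (evalPoly xs q) (evalPoly ys q))
    where
    interchange : ∀ x y Q a b → (x + y) + Q * (a + b) ≡ (x + Q * a) + (y + Q * b)
    interchange = solve-∀ ℚ-ring

  scale : ℚ → List ℚ → List ℚ
  scale c = map (c *_)

  evalPoly-scale : ∀ c xs q → evalPoly (scale c xs) q ≡ c * evalPoly xs q
  evalPoly-scale c [] q = sym (ℚ.*-zeroʳ c)
  evalPoly-scale c (x ∷ xs) q = trans (cong (λ e → c * x + ℕ→ℚ q * e) (evalPoly-scale c xs q))
    (distribute c x (ℕ→ℚ q) (evalPoly xs q))
    where
    distribute : ∀ c x Q a → c * x + Q * (c * a) ≡ c * (x + Q * a)
    distribute = solve-∀ ℚ-ring

  times-X-minus : List ℚ → ℚ → List ℚ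
  times-X-minus cs a = (0ℚ ∷ cs) ⊕ scale (- a) cs

  evalPoly-times-X-minus : ∀ cs a q → evalPoly (times-X-minus cs a) q ≡ evalPoly cs q * (ℕ→ℚ q - a)
  evalPoly-times-X-minus cs a q = begin
    evalPoly ((0ℚ ∷ cs) ⊕ scale (- a) cs) q                            ≡⟨ evalPoly-⊕ (0ℚ ∷ cs) (scale (- a) cs) q ⟩
    (0ℚ + ℕ→ℚ q * evalPoly cs q) + evalPoly (scale (- a) cs) q     ≡⟨ cong (λ e → (0ℚ + ℕ→ℚ q * evalPoly cs q) + e) (evalPoly-scale (- a) cs q) ⟩
    (0ℚ + ℕ→ℚ q * evalPoly cs q) + (- a) * evalPoly cs q            ≡⟨ collect a (ℕ→ℚ q) (evalPoly cs q) ⟩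
    evalPoly cs q * (ℕ→ℚ q - a)                                     ∎
    where
    open ≡-Reasoning
    collect : ∀ a Q E → (0ℚ + Q * E) + (- a) * E ≡ E * (Q - a)
    collect = solve-∀ ℚ-ring

  fallProdPoly : ℕ → ℕ → List ℚ
  fallProdPoly d zero = 1ℚ ∷ []
  fallProdPoly d (suc k) = times-X-minus (fallProdPoly d k) (ℕ→ℚ (suc k ℕ.* d))

  evalPoly-fallProdPoly : ∀ q d k → evalPoly (fallProdPoly d k) q ≡ toℚ (fallProd q d k)
  evalPoly-fallProdPoly q d zero = trans (cong (λ e → 1ℚ + e) (ℚ.*-zeroʳ (ℕ→ℚ q))) (ℚ.+-identityʳ 1ℚ)
  evalPoly-fallProdPoly q d (suc k) = begin
    evalPoly (times-X-minus (fallProdPoly d k) (ℕ→ℚ (suc k ℕ.* d))) q  ≡⟨ evalPoly-times-X-minus (fallProdPoly d k) _ q ⟩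
    evalPoly (fallProdPoly d k) q * (ℕ→ℚ q - ℕ→ℚ (suc k ℕ.* d))    ≡⟨ cong₂ _*_ (sym (evalPoly-fallProdPoly q d k)) (toℚ-- (ℤ.+ q) (ℤ.+ (suc k ℕ.* d))) ⟨
    toℚ (fallProd q d k) * toℚ (ℤ.+ q ℤ.- ℤ.+ (suc k ℕ.* d))                   ≡⟨ toℚ-* (fallProd q d k) _ ⟨
    toℚ (fallProd q d (suc k))                                             ∎
    where open ≡-Reasoning

  evalPoly-scale-fallProdPoly : ∀ q c d k → evalPoly (scale (toℚ (ℤ.+ c)) (fallProdPoly d k)) q ≡ toℚ (ℤ.+ c ℤ.* fallProd q d k)
  evalPoly-scale-fallProdPoly q c d k = trans (evalPoly-scale (toℚ (ℤ.+ c)) (fallProdPoly d k) q)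
    (trans (cong (toℚ (ℤ.+ c) *_) (evalPoly-fallProdPoly q d k)) (sym (toℚ-* (ℤ.+ c) (fallProd q d k))))

  deflate : List ℚ → ℕ → List ℚ
  deflate [] a = []
  deflate (c ∷ []) a = []
  deflate (c ∷ cs@(_ ∷ _)) a = evalPoly cs a ∷ deflate cs a

  length-deflate : ∀ c cs a → length (deflate (c ∷ cs) a) ≡ length cs
  length-deflate c [] a = refl
  length-deflate c (c′ ∷ cs) a = cong suc (length-deflate c′ cs a)

  factor-theorem : ∀ p a x → evalPoly p x ≡ (ℕ→ℚ x - ℕ→ℚ a) * evalPoly (deflate p a) x + evalPoly p a
  factor-theorem [] a x = lemma (ℕ→ℚ x) (ℕ→ℚ a)
    where
    lemma : ∀ X A → 0ℚ ≡ (X - A) * 0ℚ + 0ℚ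
    lemma = solve-∀ ℚ-ring
  factor-theorem (c ∷ []) a x = lemma c (ℕ→ℚ x) (ℕ→ℚ a)
    where
    lemma : ∀ c X A → c + X * 0ℚ ≡ (X - A) * 0ℚ + (c + A * 0ℚ)
    lemma = solve-∀ ℚ-ring
  factor-theorem (c ∷ cs@(_ ∷ _)) a x = trans (cong (λ e → c + ℕ→ℚ x * e) (factor-theorem cs a x))
    (lemma c (ℕ→ℚ x) (ℕ→ℚ a) (evalPoly (deflate cs a) x) (evalPoly cs a))
    where
    lemma : ∀ c X A E₁ E₂ → c + X * ((X - A) * E₁ + E₂) ≡ (X - A) * (E₂ + X * E₁) + (c + A * E₂)
    lemma = solve-∀ ℚ-ring

  private
    *-cancel-≢0 : ∀ a z → a ≢ 0ℚ → a * z ≡ 0ℚ → z ≡ 0ℚ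
    *-cancel-≢0 a z a≢0 az≡0 = begin
      z                    ≡⟨ ℚ.*-identityˡ z ⟨
      1ℚ * z               ≡⟨ cong (_* z) (ℚ.*-inverseˡ a {{a≢0′}}) ⟨
      (ℚ.1/ a) * a * z     ≡⟨ ℚ.*-assoc (ℚ.1/ a) a z ⟩
      (ℚ.1/ a) * (a * z)   ≡⟨ cong ((ℚ.1/ a) *_) az≡0 ⟩
      (ℚ.1/ a) * 0ℚ        ≡⟨ ℚ.*-zeroʳ (ℚ.1/ a) ⟩
      0ℚ                   ∎
      where
      open ≡-Reasoning
      instance
        a≢0′ : ℚ.NonZero a
        a≢0′ = ℤ.≢-nonZero (λ ↥a≡0 → a≢0 (↥p≡0⇒p≡0 a (trans (sym (ℚ.↥ᵘ-toℚᵘ a)) ↥a≡0)))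

    ℕ→ℚ-≢ : ∀ {x a} → x ≢ a → ℕ→ℚ x - ℕ→ℚ a ≢ 0ℚ
    ℕ→ℚ-≢ {x} {a} x≢a eq = x≢a (ℤ.+-injective (toℚ-injective (begin
      ℕ→ℚ x                       ≡⟨ lemma (ℕ→ℚ x) (ℕ→ℚ a) ⟩
      (ℕ→ℚ x - ℕ→ℚ a) + ℕ→ℚ a     ≡⟨ cong (_+ ℕ→ℚ a) eq ⟩
      0ℚ + ℕ→ℚ a                  ≡⟨ ℚ.+-identityˡ _ ⟩
      ℕ→ℚ a                       ∎)))
      where
      open ≡-Reasoning
      lemma : ∀ X A → X ≡ (X - A) + A
      lemma = solve-∀ ℚ-ring

  vanishing-everywhere : ∀ p (rs : List ℕ) → Unique rs → length p ≤ length rs →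
                         All (λ r → evalPoly p r ≡ 0ℚ) rs → ∀ x → evalPoly p x ≡ 0ℚ
  vanishing-everywhere [] rs _ _ _ x = refl
  vanishing-everywhere (c ∷ cs) (r ∷ rs) (r∉rs ∷ rs!) (s≤s |cs|≤|rs|) (pr≡0 ∷ p-vanishes) x = begin
    evalPoly (c ∷ cs) x                                           ≡⟨ factor-theorem (c ∷ cs) r x ⟩
    (ℕ→ℚ x - ℕ→ℚ r) * evalPoly (deflate (c ∷ cs) r) x + evalPoly (c ∷ cs) r
      ≡⟨ cong₂ (λ e e′ → (ℕ→ℚ x - ℕ→ℚ r) * e + e′) (vanishing-everywhere (deflate (c ∷ cs) r) rs rs! |q|≤|rs| q-vanishes x) pr≡0 ⟩
    (ℕ→ℚ x - ℕ→ℚ r) * 0ℚ + 0ℚ                                      ≡⟨ lemma (ℕ→ℚ x - ℕ→ℚ r) ⟩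
    0ℚ                                                            ∎
    where
    open ≡-Reasoning
    lemma : ∀ D → D * 0ℚ + 0ℚ ≡ 0ℚ
    lemma = solve-∀ ℚ-ring
    |q|≤|rs| : length (deflate (c ∷ cs) r) ≤ length rs
    |q|≤|rs| = subst (_≤ length rs) (sym (length-deflate c cs r)) |cs|≤|rs|
    deflate-vanishes : ∀ y → r ≢ y → evalPoly (c ∷ cs) y ≡ 0ℚ → evalPoly (deflate (c ∷ cs) r) y ≡ 0ℚ
    deflate-vanishes y r≢y py≡0 = *-cancel-≢0 (ℕ→ℚ y - ℕ→ℚ r) _ (ℕ→ℚ-≢ (r≢y ∘ sym)) (begin
      (ℕ→ℚ y - ℕ→ℚ r) * evalPoly (deflate (c ∷ cs) r) y                         ≡⟨ ℚ.+-identityʳ _ ⟨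
      (ℕ→ℚ y - ℕ→ℚ r) * evalPoly (deflate (c ∷ cs) r) y + 0ℚ                    ≡⟨ cong (λ e → (ℕ→ℚ y - ℕ→ℚ r) * evalPoly (deflate (c ∷ cs) r) y + e) pr≡0 ⟨
      (ℕ→ℚ y - ℕ→ℚ r) * evalPoly (deflate (c ∷ cs) r) y + evalPoly (c ∷ cs) r   ≡⟨ factor-theorem (c ∷ cs) r y ⟨
      evalPoly (c ∷ cs) y                                                       ≡⟨ py≡0 ⟩
      0ℚ                                                                        ∎)
    q-vanishes : All (λ y → evalPoly (deflate (c ∷ cs) r) y ≡ 0ℚ) rs
    q-vanishes = All.tabulate λ {y} y∈rs → deflate-vanishes y (All.lookup r∉rs y∈rs) (All.lookup p-vanishes y∈rs)

open Polynomials
open import Data.Nat using (ℕ; zero; suc; _+_; _*_; _∸_; _≤_; _<_; _≤?_; _<?_; z≤n; s≤s; s≤s⁻¹; z<s; _%_; _/_;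
  NonZero; >-nonZero; >-nonZero⁻¹; ≢-nonZero⁻¹)
open import Data.Nat.Properties
open import Data.Nat.DivMod
open import Data.Nat.Divisibility using (_∣_; divides; _∣?_; m%n≡0⇒n∣m; n∣m⇒m%n≡0; ∣⇒≤; >⇒∤; 0∣⇒≡0; ∣-refl; ∣-trans;
  ∣m∣n⇒∣m+n; ∣m+n∣m⇒∣n; n∣m*n; m∣m*n; ∣n⇒∣m*n; *-cancelˡ-∣; *-monoˡ-∣)
open import Data.Nat.GCD using (gcd; gcd-zeroʳ; gcd[m,n]∣n; c*gcd[m,n]≡gcd[cm,cn])
open import Data.Nat.Coprimality using (Coprime; coprime-divisor; coprime⇒gcd≡1; gcd≡1⇒coprime)
open import Data.Nat.Tactic.RingSolver using (solve-∀)
import Data.Integer as ℤ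
import Data.Integer.Properties as ℤ
open import Data.Rational using (ℚ; 0ℚ)
open import Data.Fin using (Fin; zero; suc; toℕ; fromℕ<; punchOut)
import Data.Fin as Fin
open import Data.Fin.Properties using (toℕ-injective; toℕ<n; toℕ-fromℕ<; *↔×; all?; any?; punchOut-injective; pigeonhole;
  toℕ-combine; combine-remQuot; remQuot-combine) renaming (_≟_ to _≟ᶠ_; suc-injective to fsuc-injective; <⇒≢ to <⇒≢ᶠ)
open import Data.Fin.Permutation using (Permutation′; _⟨$⟩ʳ_; _⟨$⟩ˡ_; inverseˡ; inverseʳ; ↔⇒≡)
open import Data.Vec using (Vec; []; _∷_; lookup; tabulate)
open import Data.Vec.Properties using (lookup∘tabulate; tabulate∘lookup; tabulate-cong; ∷-injective)
open import Data.List as List using (List; []; _∷_; _++_; length; filter; map; concatMap; cartesianProductWith; allFin; upTo)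
open import Data.List.Properties using (filter-≐; filter-some; length-map; length-upTo; length-tabulate; map-concatMap;
  concatMap-map; concatMap-cong; map-∘)
open import Data.List.Membership.Propositional using (_∈_; _∉_)
open import Data.List.Membership.Propositional.Properties using (∈-filter⁺; ∈-filter⁻; ∈-allFin; ∈-lookup; ∈-tabulate⁺;
  ∈-tabulate⁻; ∈-map⁺; ∈-map⁻; ∈-upTo⁺; ∈-upTo⁻; ∈-cartesianProductWith⁺)
open import Data.List.Membership.Propositional.Properties.WithK using (unique⇒irrelevant)
import Data.List.Membership.DecPropositional as DecMembership
open import Data.List.Relation.Unary.Any as Any using (here; there)
open import Data.List.Relation.Unary.Any.Properties using (lookup-index)
open import Data.List.Relation.Unary.All as All using (All; [])
open import Data.List.Relation.Unary.AllPairs using ([]; _∷_)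
open import Data.List.Relation.Unary.Unique.Propositional using (Unique)
import Data.List.Relation.Unary.Unique.Propositional.Properties as Unique
open import Data.Irrelevant using ([_])
open import Data.Refinement using (Refinement-syntax; _,_; value; value-injective)
open import Data.Product using (Σ; ∃-syntax; _×_; _,_; proj₁; proj₂; swap)
open import Data.Product.Function.Dependent.Propositional using (Σ-↔)
open import Data.Product.Function.NonDependent.Propositional using (_×-↔_)
open import Data.Sum using (_⊎_; inj₁; inj₂)
open import Data.Empty using (⊥-elim)
open import Data.Bool using (true; false)
open import Function using (_∘_)
open import Function.Bundles using (_↔_; mk↔ₛ′; Inverse)
open import Function.Properties.Inverse using (↔-trans; ↔-sym; ↔-refl)
open import Relation.Binary.PropositionalEquality
open import Relation.Binary.Definitions using (tri<; tri≈; tri>)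
open import Relation.Nullary using (Dec; yes; no; does; ¬_; ¬?)
open import Relation.Nullary.Decidable using (recompute; _×-dec_; _→-dec_)
open import Relation.Unary using (Pred; Decidable; _≐_)
open import Relation.Unary.Properties using (∁?; _∩?_)
open import Level using (0ℓ)

-- Counting by enumeration

index-∈-lookup : ∀ {A : Set} {xs : List A} (i : Fin (length xs)) → Any.index (∈-lookup {xs = xs} i) ≡ i
index-∈-lookup {xs = _ ∷ _} zero = refl
index-∈-lookup {xs = _ ∷ _} (suc i) = cong suc (index-∈-lookup i)

module _ {A : Set} {P : Pred A 0ℓ} (P? : Decidable P) where

  enumeration-↔ : (xs : List A) → Unique xs → (∀ {x} → P x → x ∈ xs) → (∀ {x} → x ∈ xs → P x) →
                  [ x ∈ A ∣ P x ] ↔ Fin (length xs)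
  enumeration-↔ xs xs! complete sound = mk↔ₛ′ to from to∘from from∘to
    where
    to : [ x ∈ A ∣ P x ] → Fin (length xs)
    to (x , [ px ]) = Any.index (complete (recompute (P? x) px))
    from : Fin (length xs) → [ x ∈ A ∣ P x ]
    from i = List.lookup xs i , [ sound (∈-lookup {xs = xs} i) ]
    to∘from : ∀ i → to (from i) ≡ i
    to∘from i = trans (cong Any.index (unique⇒irrelevant xs! _ (∈-lookup {xs = xs} i))) (index-∈-lookup {xs = xs} i)
    from∘to : ∀ y → from (to y) ≡ y
    from∘to (x , [ px ]) = value-injective (sym (lookup-index (complete (recompute (P? x) px))))

  length-filter+length-filter-∁ : ∀ xs → length (filter P? xs) + length (filter (∁? P?) xs) ≡ length xs
  length-filter+length-filter-∁ [] = refl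
  length-filter+length-filter-∁ (x ∷ xs) with P? x
  ... | yes px = cong suc (length-filter+length-filter-∁ xs)
  ... | no ¬px = trans (+-suc _ _) (cong suc (length-filter+length-filter-∁ xs))

module _ {A : Set} {P : Pred A 0ℓ} (P? : Decidable P) where

  filter-↔ : (xs : List A) → Unique xs → (∀ x → x ∈ xs) → [ x ∈ A ∣ P x ] ↔ Fin (length (filter P? xs))
  filter-↔ xs xs! all∈ = enumeration-↔ P? (filter P? xs) (Unique.filter⁺ P? xs!)
    (λ {x} → ∈-filter⁺ P? (all∈ x)) (λ x∈ → proj₂ (∈-filter⁻ P? {xs = xs} x∈))

complement-↔ : ∀ {m} (S : List (Fin m)) → Unique S → [ s ∈ Fin m ∣ s ∉ S ] ↔ Fin (m ∸ length S)
complement-↔ {m} S S! = subst (λ k → [ s ∈ Fin m ∣ s ∉ S ] ↔ Fin k) |outside|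
  (filter-↔ (∁? (_∈? S)) (allFin m) (Unique.allFin⁺ m) ∈-allFin)
  where
  open DecMembership _≟ᶠ_ using (_∈?_)
  |inside| : length (filter (_∈? S) (allFin m)) ≡ length S
  |inside| = ↔⇒≡ (↔-trans (↔-sym (filter-↔ (_∈? S) (allFin m) (Unique.allFin⁺ m) ∈-allFin))
                          (enumeration-↔ (_∈? S) S S! (λ s∈S → s∈S) (λ s∈S → s∈S)))
  |outside| : length (filter (∁? (_∈? S)) (allFin m)) ≡ m ∸ length S
  |outside| = trans (sym (m+n∸m≡n (length (filter (_∈? S) (allFin m))) _))
    (cong₂ _∸_ (trans (length-filter+length-filter-∁ (_∈? S) (allFin m)) (length-tabulate {n = m} (λ i → i))) |inside|)

module _ {A B : Set} {P : Pred B 0ℓ} (P? : Decidable P) where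

  filter-map : (f : A → B) → ∀ xs → filter P? (map f xs) ≡ map f (filter (P? ∘ f) xs)
  filter-map f [] = refl
  filter-map f (x ∷ xs) with does (P? (f x))
  ... | true = cong (f x ∷_) (filter-map f xs)
  ... | false = filter-map f xs

module _ {A : Set} {P Q : Pred A 0ℓ} (P? : Decidable P) (Q? : Decidable Q) where

  filter-filter : ∀ xs → filter Q? (filter P? xs) ≡ filter (P? ∩? Q?) xs
  filter-filter [] = refl
  filter-filter (x ∷ xs) with does (P? x)
  ... | false = filter-filter xs
  ... | true with does (Q? x)
  ...   | true = cong (x ∷_) (filter-filter xs)
  ...   | false = filter-filter xs

recomputed : ∀ {A : Set} {P : Pred A 0ℓ} → Decidable P → (x : [ a ∈ A ∣ P a ]) → P (value x)
recomputed P? (x , [ px ]) = recompute (P? x) px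

↔-Fin-empty : ∀ {A : Set} {n} → ¬ A → A ↔ Fin n → n ≡ 0
↔-Fin-empty {n = zero} _ _ = refl
↔-Fin-empty {n = suc n} ¬a ι = ⊥-elim (¬a (Inverse.from ι zero))

-- Congruences

∣[+a]-[+b]∣≡a∸b : ∀ {a b} → b ≤ a → ℤ.∣ ℤ.+ a ℤ.- ℤ.+ b ∣ ≡ a ∸ b
∣[+a]-[+b]∣≡a∸b {a} {b} b≤a = trans (cong ℤ.∣_∣ (ℤ.[+m]-[+n]≡m⊖n a b)) (trans (ℤ.∣m⊖n∣≡∣n⊖m∣ a b) (ℤ.∣⊖∣-≤ b≤a))

[mod]-sym : ∀ {a b q} → a ≡ b [mod q ] → b ≡ a [mod q ]
[mod]-sym {a} {b} {q} = subst (q ∣_) (begin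
  ℤ.∣ ℤ.+ a ℤ.- ℤ.+ b ∣ ≡⟨ cong ℤ.∣_∣ (ℤ.[+m]-[+n]≡m⊖n a b) ⟩
  ℤ.∣ a ℤ.⊖ b ∣         ≡⟨ ℤ.∣m⊖n∣≡∣n⊖m∣ a b ⟩
  ℤ.∣ b ℤ.⊖ a ∣         ≡⟨ cong ℤ.∣_∣ (ℤ.[+m]-[+n]≡m⊖n b a) ⟨
  ℤ.∣ ℤ.+ b ℤ.- ℤ.+ a ∣ ∎)
  where open ≡-Reasoning

module Mod (q : ℕ) {{_ : NonZero q}} where

  infix 4 _≋_
  _≋_ : ℕ → ℕ → Set
  a ≋ b = a % q ≡ b % q

  0%q≡0 : 0 % q ≡ 0
  0%q≡0 = m<n⇒m%n≡m (>-nonZero⁻¹ q)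

  ≋-+ : ∀ {a b c e} → a ≋ b → c ≋ e → a + c ≋ b + e
  ≋-+ {a} {b} {c} {e} a≋b c≋e =
    trans (%-distribˡ-+ a c q) (trans (cong₂ (λ x y → (x + y) % q) a≋b c≋e) (sym (%-distribˡ-+ b e q)))

  ∣∸⇒≋ : ∀ {a b} → b ≤ a → q ∣ a ∸ b → a ≋ b
  ∣∸⇒≋ {a} {b} b≤a q∣a∸b = trans (cong (_% q) (sym (m∸n+n≡m b≤a))) (%-remove-+ˡ b q∣a∸b)

  ≋⇒∣∸ : ∀ {a b} → b ≤ a → a ≋ b → q ∣ a ∸ b
  ≋⇒∣∸ {a} {b} b≤a a≋b = divides (a / q ∸ b / q) (begin
    a ∸ b                                         ≡⟨ cong₂ _∸_ (m≡m%n+[m/n]*n a q) (m≡m%n+[m/n]*n b q) ⟩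
    (a % q + a / q * q) ∸ (b % q + b / q * q)     ≡⟨ cong (λ r → (r + a / q * q) ∸ (b % q + b / q * q)) a≋b ⟩
    (b % q + a / q * q) ∸ (b % q + b / q * q)     ≡⟨ [m+n]∸[m+o]≡n∸o (b % q) _ _ ⟩
    a / q * q ∸ b / q * q                         ≡⟨ *-distribʳ-∸ q (a / q) (b / q) ⟨
    (a / q ∸ b / q) * q                           ∎)
    where open ≡-Reasoning

  ≋-cancelˡ : ∀ b {x y} → b + x ≋ b + y → x ≋ y
  ≋-cancelˡ b {x} {y} eq with ≤-total y x
  ... | inj₁ y≤x = ∣∸⇒≋ y≤x (subst (q ∣_) ([m+n]∸[m+o]≡n∸o b x y) (≋⇒∣∸ (+-monoʳ-≤ b y≤x) eq))
  ... | inj₂ x≤y = sym (∣∸⇒≋ x≤y (subst (q ∣_) ([m+n]∸[m+o]≡n∸o b y x) (≋⇒∣∸ (+-monoʳ-≤ b x≤y) (sym eq))))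

  [mod]⇒≋ : ∀ {a b} → a ≡ b [mod q ] → a ≋ b
  [mod]⇒≋ {a} {b} a≡b with ≤-total b a
  ... | inj₁ b≤a = ∣∸⇒≋ b≤a (subst (q ∣_) (∣[+a]-[+b]∣≡a∸b b≤a) a≡b)
  ... | inj₂ a≤b = sym (∣∸⇒≋ a≤b (subst (q ∣_) (∣[+a]-[+b]∣≡a∸b a≤b) ([mod]-sym {a} {b} a≡b)))

  ≋⇒[mod] : ∀ {a b} → a ≋ b → a ≡ b [mod q ]
  ≋⇒[mod] {a} {b} a≋b with ≤-total b a
  ... | inj₁ b≤a = subst (q ∣_) (sym (∣[+a]-[+b]∣≡a∸b b≤a)) (≋⇒∣∸ b≤a a≋b)
  ... | inj₂ a≤b = [mod]-sym {b} {a} (subst (q ∣_) (sym (∣[+a]-[+b]∣≡a∸b a≤b)) (≋⇒∣∸ a≤b (sym a≋b)))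

  ∣⇒≋0 : ∀ {a} → q ∣ a → a ≋ 0
  ∣⇒≋0 {a} q∣a = trans (n∣m⇒m%n≡0 a q q∣a) (sym 0%q≡0)

  ≋0⇒∣ : ∀ {a} → a ≋ 0 → q ∣ a
  ≋0⇒∣ {a} a≋0 = m%n≡0⇒n∣m a q (trans a≋0 0%q≡0)

  ≋-∣ : ∀ {e a b} {{_ : NonZero e}} → e ∣ q → a ≋ b → e ∣ b → e ∣ a
  ≋-∣ {e} {a} {b} e∣q a≋b e∣b = m%n≡0⇒n∣m a e (begin
    a % e        ≡⟨ m∣n⇒o%n%m≡o%m e q a e∣q ⟨
    a % q % e    ≡⟨ cong (_% e) a≋b ⟩
    b % q % e    ≡⟨ m∣n⇒o%n%m≡o%m e q b e∣q ⟩
    b % e        ≡⟨ n∣m⇒m%n≡0 b e e∣b ⟩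
    0            ∎)
    where open ≡-Reasoning

-- The points of Z/qZ

-- Points are functions, which cannot be compared without extensionality, so they are enumerated as vectors.
vectors : (k q : ℕ) → List (Vec (Fin q) k)
vectors k q = map tabulate (allFuns k q)

concatMap-map≡cartesianProductWith : ∀ {A B C : Set} (f : A → B → C) xs ys →
  concatMap (λ x → map (f x) ys) xs ≡ cartesianProductWith f xs ys
concatMap-map≡cartesianProductWith f [] ys = refl
concatMap-map≡cartesianProductWith f (x ∷ xs) ys = cong (map (f x) ys ++_) (concatMap-map≡cartesianProductWith f xs ys)

vectors-suc : ∀ k q → vectors (suc k) q ≡ cartesianProductWith (λ v c → c ∷ v) (vectors k q) (allFin q)
vectors-suc k q = begin
  map tabulate (concatMap _ (allFuns k q))                                   ≡⟨ map-concatMap tabulate _ (allFuns k q) ⟩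
  concatMap (λ f → map tabulate (map _ (allFin q))) (allFuns k q)            ≡⟨ concatMap-cong (λ f → map-∘ (allFin q)) (allFuns k q) ⟨
  concatMap (λ f → map (λ c → c ∷ tabulate f) (allFin q)) (allFuns k q)      ≡⟨ concatMap-map (λ v → map (_∷ v) (allFin q)) tabulate (allFuns k q) ⟨
  concatMap (λ v → map (_∷ v) (allFin q)) (vectors k q)                      ≡⟨ concatMap-map≡cartesianProductWith (λ v c → c ∷ v) (vectors k q) (allFin q) ⟩
  cartesianProductWith (λ v c → c ∷ v) (vectors k q) (allFin q)              ∎
  where open ≡-Reasoning

vectors-unique : ∀ k q → Unique (vectors k q)
vectors-unique zero q = [] ∷ []
vectors-unique (suc k) q rewrite vectors-suc k q =
  Unique.cartesianProductWith⁺ (λ v c → c ∷ v) (swap ∘ ∷-injective) (vectors-unique k q) (Unique.allFin⁺ q)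

∈-vectors : ∀ {k q} (v : Vec (Fin q) k) → v ∈ vectors k q
∈-vectors [] = here refl
∈-vectors {suc k} {q} (c ∷ v) rewrite vectors-suc k q =
  ∈-cartesianProductWith⁺ (λ v c → c ∷ v) (∈-vectors v) (∈-allFin c)

module _ {ℓ q : ℕ} where

  coord-cong : ∀ {a b : Point ℓ q} → (∀ i → a i ≡ b i) → ∀ i → coord a i ≡ coord b i
  coord-cong a≗b zero = refl
  coord-cong a≗b (suc i) = cong toℕ (a≗b i)

  InM-cong : ∀ {a b : Point ℓ q} → (∀ i → a i ≡ b i) → InM a → InM b
  InM-cong a≗b a∈M i j i≢j eq =
    a∈M i j i≢j (subst₂ (λ x y → x ≡ y [mod q ]) (sym (coord-cong a≗b i)) (sym (coord-cong a≗b j)) eq)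

  Fixed-cong : ∀ {σ} {a b : Point ℓ q} → (∀ i → a i ≡ b i) → Fixed σ a → Fixed σ b
  Fixed-cong {σ} a≗b fixed k = subst₂ (λ x y → x ≡ y [mod q ]) (coord-cong a≗b (σ ⟨$⟩ˡ k))
    (cong₂ _+_ (coord-cong a≗b k) (coord-cong a≗b (σ ⟨$⟩ˡ zero))) (fixed k)

  module _ (σ : Permutation′ (suc ℓ)) where

    FixedInM : Vec (Fin q) ℓ → Set
    FixedInM v = InM (lookup v) × Fixed σ (lookup v)

    FixedInM? : Decidable FixedInM
    FixedInM? v = InM? (lookup v) ×-dec Fixed? σ (lookup v)

    χ≡length-filter-vectors : χ ℓ q σ ≡ length (filter FixedInM? (vectors ℓ q))
    χ≡length-filter-vectors = begin
      length (filter (Fixed? σ) (filter InM? (allFuns ℓ q)))          ≡⟨ cong length (filter-filter InM? (Fixed? σ) (allFuns ℓ q)) ⟩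
      length (filter (InM? ∩? Fixed? σ) (allFuns ℓ q))                ≡⟨ cong length (filter-≐ (InM? ∩? Fixed? σ) (FixedInM? ∘ tabulate) tabulated (allFuns ℓ q)) ⟩
      length (filter (FixedInM? ∘ tabulate) (allFuns ℓ q))            ≡⟨ length-map tabulate (filter (FixedInM? ∘ tabulate) (allFuns ℓ q)) ⟨
      length (map tabulate (filter (FixedInM? ∘ tabulate) (allFuns ℓ q))) ≡⟨ cong length (filter-map FixedInM? tabulate (allFuns ℓ q)) ⟨
      length (filter FixedInM? (vectors ℓ q))                          ∎
      where
      open ≡-Reasoning
      tabulate-lookup⁻¹ : (a : Point ℓ q) → ∀ i → a i ≡ lookup (tabulate a) i
      tabulate-lookup⁻¹ a i = sym (lookup∘tabulate a i)
      tabulated : (λ a → InM a × Fixed σ a) ≐ (FixedInM ∘ tabulate)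
      tabulated = (λ {a} (a∈M , fixed) → InM-cong (tabulate-lookup⁻¹ a) a∈M , Fixed-cong {σ} (tabulate-lookup⁻¹ a) fixed)
                , (λ {a} (a∈M , fixed) → InM-cong (lookup∘tabulate a) a∈M , Fixed-cong {σ} (lookup∘tabulate a) fixed)

    χ-↔ : [ v ∈ Vec (Fin q) ℓ ∣ FixedInM v ] ↔ Fin (χ ℓ q σ)
    χ-↔ = subst (λ n → [ v ∈ Vec (Fin q) ℓ ∣ FixedInM v ] ↔ Fin n) (sym χ≡length-filter-vectors)
      (filter-↔ FixedInM? (vectors ℓ q) (vectors-unique ℓ q) ∈-vectors)

-- Orbits of a permutation of cycle type (d, …, d)

iter-+ : ∀ {n} (σ : Permutation′ n) a b i → iter σ (a + b) i ≡ iter σ a (iter σ b i)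
iter-+ σ zero b i = refl
iter-+ σ (suc a) b i = cong (σ ⟨$⟩ʳ_) (iter-+ σ a b i)

lower-bound-suc : ∀ (f : ℕ → ℕ) {m k} → m ≤ f (suc k) → (∀ s → s ≤ k → m ≤ f s) → ∀ s → s ≤ suc k → m ≤ f s
lower-bound-suc f m≤f[k+1] m≤f s s≤k+1 with m≤n⇒m<n∨m≡n s≤k+1
... | inj₁ s<k+1 = m≤f s (s≤s⁻¹ s<k+1)
... | inj₂ refl = m≤f[k+1]

minimiser : (f : ℕ → ℕ) (k : ℕ) → ∃[ t ] t ≤ k × (∀ s → s ≤ k → f t ≤ f s)
minimiser f zero = 0 , z≤n , λ { .zero z≤n → ≤-refl }
minimiser f (suc k) with minimiser f k
... | t , t≤k , t-min with f (suc k) <? f t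
...   | yes fk<ft = suc k , ≤-refl , lower-bound-suc f ≤-refl (λ s s≤k → ≤-trans (<⇒≤ fk<ft) (t-min s s≤k))
...   | no fk≮ft = t , m≤n⇒m≤1+n t≤k , lower-bound-suc f (≮⇒≥ fk≮ft) t-min

module Cycles {ℓ d′ : ℕ} {σ : Permutation′ (suc ℓ)} (cycles : CycleType (suc d′) σ) where

  private
    d : ℕ
    d = suc d′

  iter-period : ∀ k i → iter σ (k * d) i ≡ i
  iter-period zero i = refl
  iter-period (suc k) i = trans (iter-+ σ d (k * d) i) (trans (cong (iter σ d) (iter-period k i)) (proj₁ (cycles i)))

  iter-% : ∀ a i → iter σ a i ≡ iter σ (a % d) i
  iter-% a i = begin
    iter σ a i                            ≡⟨ cong (λ t → iter σ t i) (m≡m%n+[m/n]*n a d) ⟩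
    iter σ (a % d + a / d * d) i          ≡⟨ iter-+ σ (a % d) _ i ⟩
    iter σ (a % d) (iter σ (a / d * d) i) ≡⟨ cong (iter σ (a % d)) (iter-period (a / d) i) ⟩
    iter σ (a % d) i                      ∎
    where open ≡-Reasoning

  iter-undo : ∀ s i → iter σ (s * d′) (iter σ s i) ≡ i
  iter-undo s i = trans (sym (iter-+ σ (s * d′) s i))
    (trans (cong (λ t → iter σ t i) (trans (+-comm (s * d′) s) (sym (*-suc s d′)))) (iter-period s i))

  private
    iter-≢ : ∀ i {a b} → a < b → b < d → iter σ a i ≢ iter σ b i
    iter-≢ i {a} {b} a<b b<d eq = proj₂ (cycles (iter σ a i)) (b ∸ a) (m<n⇒0<n∸m a<b) (≤-<-trans (m∸n≤m b a) b<d)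
      (trans (sym (iter-+ σ (b ∸ a) a i)) (trans (cong (λ t → iter σ t i) (m∸n+n≡m (<⇒≤ a<b))) (sym eq)))

  iter-injective : ∀ i {a b} → a < d → b < d → iter σ a i ≡ iter σ b i → a ≡ b
  iter-injective i {a} {b} a<d b<d eq with <-cmp a b
  ... | tri< a<b _ _ = ⊥-elim (iter-≢ i a<b b<d eq)
  ... | tri≈ _ a≡b _ = a≡b
  ... | tri> _ _ b<a = ⊥-elim (iter-≢ i b<a a<d (sym eq))

  iter-≡⇒%≡ : ∀ i a b → iter σ a i ≡ iter σ b i → a % d ≡ b % d
  iter-≡⇒%≡ i a b eq = iter-injective i (m%n<n a d) (m%n<n b d) (trans (sym (iter-% a i)) (trans eq (iter-% b i)))

  offset : Fin (suc ℓ) → ℕ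
  offset i = proj₁ (minimiser (λ t → toℕ (iter σ t i)) d′)

  rep : Fin (suc ℓ) → Fin (suc ℓ)
  rep i = iter σ (offset i) i

  rep-minimal : ∀ i t → toℕ (rep i) ≤ toℕ (iter σ t i)
  rep-minimal i t = subst (λ x → toℕ (rep i) ≤ toℕ x) (sym (iter-% t i))
    (proj₂ (proj₂ (minimiser (λ t → toℕ (iter σ t i)) d′)) (t % d) (s≤s⁻¹ (m%n<n t d)))

  rep-iter : ∀ s x → rep (iter σ s x) ≡ rep x
  rep-iter s x = toℕ-injective (≤-antisym
    (subst (λ z → toℕ (rep (iter σ s x)) ≤ toℕ z) (trans (iter-+ σ (offset x) (s * d′) _) (cong (iter σ (offset x)) (iter-undo s x)))
      (rep-minimal (iter σ s x) (offset x + s * d′)))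
    (subst (λ z → toℕ (rep x) ≤ toℕ z) (iter-+ σ (offset (iter σ s x)) s x) (rep-minimal x (offset (iter σ s x) + s))))

  rep-idempotent : ∀ x → rep (rep x) ≡ rep x
  rep-idempotent x = rep-iter (offset x) x

  rep-zero : rep zero ≡ zero
  rep-zero = toℕ-injective (n≤0⇒n≡0 (rep-minimal zero 0))

  position : Fin (suc ℓ) → Fin d
  position i = fromℕ< (m%n<n (offset i * d′) d)

  iter-position-rep : ∀ i → iter σ (toℕ (position i)) (rep i) ≡ i
  iter-position-rep i = trans (cong (λ t → iter σ t (rep i)) (toℕ-fromℕ< (m%n<n (offset i * d′) d)))
    (trans (sym (iter-% (offset i * d′) (rep i))) (iter-undo (offset i) i))

  position-unique : ∀ i t → iter σ (toℕ t) (rep i) ≡ i → position i ≡ t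
  position-unique i t eq = toℕ-injective (iter-injective (rep i) (toℕ<n (position i)) (toℕ<n t)
    (trans (iter-position-rep i) (sym eq)))

  private
    others : List (Fin (suc ℓ))
    others = filter (λ x → rep x ≟ᶠ x) (List.tabulate suc)

  -- zero comes first, so that its orbit gets index zero and root zero = zero holds by computation.
  representatives : List (Fin (suc ℓ))
  representatives = zero ∷ others

  representatives-unique : Unique representatives
  representatives-unique = All.tabulate zero∉others ∷ Unique.filter⁺ (λ x → rep x ≟ᶠ x) (Unique.tabulate⁺ fsuc-injective)
    where
    zero∉others : ∀ {x} → x ∈ others → zero ≢ x
    zero∉others x∈others refl with ∈-tabulate⁻ {f = suc} (proj₁ (∈-filter⁻ (λ x → rep x ≟ᶠ x) {xs = List.tabulate suc} x∈others))
    ... | _ , ()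

  ∈-representatives : ∀ {x} → rep x ≡ x → x ∈ representatives
  ∈-representatives {zero} _ = here refl
  ∈-representatives {suc y} rep-y = there (∈-filter⁺ (λ x → rep x ≟ᶠ x) (∈-tabulate⁺ y) rep-y)

  representatives-rep : ∀ {x} → x ∈ representatives → rep x ≡ x
  representatives-rep (here refl) = rep-zero
  representatives-rep (there x∈others) = proj₂ (∈-filter⁻ (λ x → rep x ≟ᶠ x) {xs = List.tabulate suc} x∈others)

  g′ : ℕ
  g′ = length others

  roots-↔ : [ x ∈ Fin (suc ℓ) ∣ rep x ≡ x ] ↔ Fin (suc g′)
  roots-↔ = enumeration-↔ (λ x → rep x ≟ᶠ x) representatives representatives-unique ∈-representatives representatives-rep

  root : Fin (suc g′) → Fin (suc ℓ)
  root J = value (Inverse.from roots-↔ J)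

  rep-root : ∀ J → rep (root J) ≡ root J
  rep-root J = recomputed (λ x → rep x ≟ᶠ x) (Inverse.from roots-↔ J)

  canonical : Fin (suc ℓ) → [ x ∈ Fin (suc ℓ) ∣ rep x ≡ x ]
  canonical x = rep x , [ rep-idempotent x ]

  orbit-index : Fin (suc ℓ) → Fin (suc g′)
  orbit-index x = Inverse.to roots-↔ (canonical x)

  root-orbit-index : ∀ x → root (orbit-index x) ≡ rep x
  root-orbit-index x = cong value (Inverse.strictlyInverseʳ roots-↔ (canonical x))

  orbit-index-root : ∀ J → orbit-index (root J) ≡ J
  orbit-index-root J = trans (cong (Inverse.to roots-↔) (value-injective {v = canonical (root J)} {w = Inverse.from roots-↔ J} (rep-root J)))
    (Inverse.strictlyInverseˡ roots-↔ J)

  orbit-index-iter : ∀ s x → orbit-index (iter σ s x) ≡ orbit-index x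
  orbit-index-iter s x = cong (Inverse.to roots-↔) (value-injective {v = canonical (iter σ s x)} {w = canonical x} (rep-iter s x))

  iter-position-root : ∀ x → iter σ (toℕ (position x)) (root (orbit-index x)) ≡ x
  iter-position-root x = trans (cong (iter σ (toℕ (position x))) (root-orbit-index x)) (iter-position-rep x)

  position-root : ∀ J → toℕ (position (root J)) ≡ 0
  position-root J = cong toℕ (position-unique (root J) zero (rep-root J))

  orbit-↔ : Fin (suc ℓ) ↔ (Fin (suc g′) × Fin d)
  orbit-↔ = mk↔ₛ′ to from to∘from iter-position-root
    where
    to : Fin (suc ℓ) → Fin (suc g′) × Fin d
    to x = orbit-index x , position x
    from : Fin (suc g′) × Fin d → Fin (suc ℓ)
    from (J , t) = iter σ (toℕ t) (root J)
    to∘from : ∀ Jt → to (from Jt) ≡ Jt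
    to∘from (J , t) = cong₂ _,_ (trans (orbit-index-iter (toℕ t) (root J)) (orbit-index-root J))
      (position-unique _ t (cong (iter σ (toℕ t)) (trans (rep-iter (toℕ t) (root J)) (rep-root J))))

  orbits*d≡n : suc g′ * d ≡ suc ℓ
  orbits*d≡n = sym (↔⇒≡ (↔-trans orbit-↔ (↔-sym *↔×)))

  root-zero : root zero ≡ zero
  root-zero = refl

  orbit-index-zero : orbit-index zero ≡ zero
  orbit-index-zero = orbit-index-root zero

  position-zero : toℕ (position zero) ≡ 0
  position-zero = cong toℕ (position-unique zero zero rep-zero)

  position-σ : ∀ i → toℕ (position (σ ⟨$⟩ʳ i)) ≡ suc (toℕ (position i)) % d
  position-σ i = trans (sym (m<n⇒m%n≡m (toℕ<n (position (σ ⟨$⟩ʳ i)))))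
    (iter-≡⇒%≡ (rep i) (toℕ (position (σ ⟨$⟩ʳ i))) (suc (toℕ (position i))) (begin
      iter σ (toℕ (position (σ ⟨$⟩ʳ i))) (rep i)              ≡⟨ cong (iter σ (toℕ (position (σ ⟨$⟩ʳ i)))) (rep-iter 1 i) ⟨
      iter σ (toℕ (position (σ ⟨$⟩ʳ i))) (rep (σ ⟨$⟩ʳ i))     ≡⟨ iter-position-rep (σ ⟨$⟩ʳ i) ⟩
      σ ⟨$⟩ʳ i                                               ≡⟨ cong (σ ⟨$⟩ʳ_) (iter-position-rep i) ⟨
      iter σ (suc (toℕ (position i))) (rep i)                ∎))
    where open ≡-Reasoning

-- A fixed point in M(A;q) determines the cycle type

none-below-suc : ∀ {P : ℕ → Set} {N} → (∀ j → j < N → ¬ P j) → ¬ P N → ∀ j → j < suc N → ¬ P j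
none-below-suc none ¬pN j j<N+1 with m<1+n⇒m<n∨m≡n j<N+1
... | inj₁ j<N = none j j<N
... | inj₂ refl = ¬pN

search : ∀ {P : ℕ → Set} → Decidable P → ∀ N → (∃[ k ] P k × (∀ j → j < k → ¬ P j)) ⊎ (∀ j → j < N → ¬ P j)
search P? zero = inj₂ (λ _ ())
search P? (suc N) with search P? N
... | inj₁ least = inj₁ least
... | inj₂ none with P? N
...   | yes pN = inj₁ (N , pN , none)
...   | no ¬pN = inj₂ (none-below-suc none ¬pN)

least-witness : ∀ {P : ℕ → Set} → Decidable P → ∀ {N} → P N → ∃[ k ] P k × (∀ j → j < k → ¬ P j)
least-witness P? {N} pN with search P? (suc N)
... | inj₁ least = least
... | inj₂ none = ⊥-elim (none N ≤-refl pN)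

module _ (q : ℕ) {{_ : NonZero q}} where

  additive-order : ∀ C → ∃[ d ] 0 < d × d ∣ q × q ∣ d * C × (∀ t → 0 < t → t < d → ¬ q ∣ t * C)
  additive-order C with least-witness (λ k → q ∣? suc k * C) {q ∸ 1} (subst (λ x → q ∣ x * C) (sym (suc-pred q)) (m∣m*n C))
  ... | k , q∣dC , minimal = suc k , z<s , d∣q , q∣dC , λ { (suc t) _ t<d → minimal t (s≤s⁻¹ t<d) }
    where
    d r : ℕ
    d = suc k
    r = q % d
    q∣rC : q ∣ r * C
    q∣rC = ∣m+n∣m⇒∣n (subst (q ∣_) (qC≡rC+[q/d]dC) (m∣m*n C)) (∣n⇒∣m*n (q / d) q∣dC)
      where
      qC≡rC+[q/d]dC : q * C ≡ q / d * (d * C) + r * C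
      qC≡rC+[q/d]dC = begin
        q * C                       ≡⟨ cong (_* C) (m≡m%n+[m/n]*n q d) ⟩
        (r + q / d * d) * C         ≡⟨ *-distribʳ-+ C r (q / d * d) ⟩
        r * C + q / d * d * C       ≡⟨ cong (r * C +_) (*-assoc (q / d) d C) ⟩
        r * C + q / d * (d * C)     ≡⟨ +-comm (r * C) _ ⟩
        q / d * (d * C) + r * C     ∎
        where open ≡-Reasoning
    d∣q : d ∣ q
    d∣q with q % d in q%d≡r
    ... | zero = m%n≡0⇒n∣m q d q%d≡r
    ... | suc r′ = ⊥-elim (minimal r′ (s≤s⁻¹ (subst (_< d) q%d≡r (m%n<n q d))) (subst (λ x → q ∣ x * C) q%d≡r q∣rC))

module Shift {ℓ q : ℕ} {{_ : NonZero q}} (σ : Permutation′ (suc ℓ)) (a : Point ℓ q) where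
  open Mod q

  private
    A : Fin (suc ℓ) → ℕ
    A = coord a

  shift : ℕ
  shift = A (σ ⟨$⟩ʳ zero)

  Shifts : Set
  Shifts = ∀ j → A (σ ⟨$⟩ʳ j) ≋ A j + shift

  private
    shift-inverse : (π ρ : Fin (suc ℓ) → Fin (suc ℓ)) → (∀ j → ρ (π j) ≡ j) →
      (∀ k → A (ρ k) ≋ A k + A (ρ zero)) → ∀ j → A (π j) ≋ A j + A (π zero)
    shift-inverse π ρ ρπ≡id ρ-shifts j = sym (begin
      (A j + A (π zero)) % q                    ≡⟨ ≋-+ {A j} (subst (λ x → A x ≋ A (π j) + A (ρ zero)) (ρπ≡id j) (ρ-shifts (π j))) refl ⟩
      (A (π j) + A (ρ zero) + A (π zero)) % q   ≡⟨ cong (_% q) (+-assoc (A (π j)) _ _) ⟩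
      (A (π j) + (A (ρ zero) + A (π zero))) % q ≡⟨ ≋-+ {A (π j)} refl (sym 0≋ρ0+π0) ⟩
      (A (π j) + 0) % q                         ≡⟨ cong (_% q) (+-identityʳ _) ⟩
      A (π j) % q                               ∎)
      where
      open ≡-Reasoning
      0≋ρ0+π0 : 0 ≋ A (ρ zero) + A (π zero)
      0≋ρ0+π0 = trans (subst (λ x → A x ≋ A (π zero) + A (ρ zero)) (ρπ≡id zero) (ρ-shifts (π zero)))
                      (cong (_% q) (+-comm (A (π zero)) _))

  Fixed⇒Shifts : Fixed σ a → Shifts
  Fixed⇒Shifts fixed = shift-inverse (σ ⟨$⟩ʳ_) (σ ⟨$⟩ˡ_) (λ _ → inverseˡ σ) (λ k → [mod]⇒≋ (fixed k))

  Shifts⇒Fixed : Shifts → Fixed σ a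
  Shifts⇒Fixed shifts k = ≋⇒[mod] (shift-inverse (σ ⟨$⟩ˡ_) (σ ⟨$⟩ʳ_) (λ _ → inverseʳ σ) shifts k)

  iter-Shifts : Shifts → ∀ t j → A (iter σ t j) ≋ A j + t * shift
  iter-Shifts shifts zero j = cong (_% q) (sym (+-identityʳ (A j)))
  iter-Shifts shifts (suc t) j = begin
    A (σ ⟨$⟩ʳ iter σ t j) % q      ≡⟨ shifts (iter σ t j) ⟩
    (A (iter σ t j) + shift) % q   ≡⟨ ≋-+ {A (iter σ t j)} (iter-Shifts shifts t j) refl ⟩
    (A j + t * shift + shift) % q  ≡⟨ cong (_% q) (trans (+-assoc (A j) _ _) (cong (A j +_) (+-comm (t * shift) shift))) ⟩
    (A j + suc t * shift) % q      ∎
    where open ≡-Reasoning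

  InM⇒coord-injective : InM a → ∀ i j → A i ≋ A j → i ≡ j
  InM⇒coord-injective a∈M i j Ai≋Aj with i ≟ᶠ j
  ... | yes i≡j = i≡j
  ... | no i≢j = ⊥-elim (a∈M i j i≢j (≋⇒[mod] Ai≋Aj))

  module _ (a∈M : InM a) (shifts : Shifts) (t : ℕ) (i : Fin (suc ℓ)) where

    iter-fixes⇒∣ : iter σ t i ≡ i → q ∣ t * shift
    iter-fixes⇒∣ fixes = ≋0⇒∣ (≋-cancelˡ (A i) (begin
      (A i + t * shift) % q  ≡⟨ iter-Shifts shifts t i ⟨
      A (iter σ t i) % q     ≡⟨ cong (λ x → A x % q) fixes ⟩
      A i % q                ≡⟨ cong (_% q) (+-identityʳ (A i)) ⟨
      (A i + 0) % q          ∎))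
      where open ≡-Reasoning

    ∣⇒iter-fixes : q ∣ t * shift → iter σ t i ≡ i
    ∣⇒iter-fixes q∣tC = InM⇒coord-injective a∈M _ _ (begin
      A (iter σ t i) % q     ≡⟨ iter-Shifts shifts t i ⟩
      (A i + t * shift) % q  ≡⟨ ≋-+ {A i} refl (∣⇒≋0 q∣tC) ⟩
      (A i + 0) % q          ≡⟨ cong (_% q) (+-identityʳ (A i)) ⟩
      A i % q                ∎)
      where open ≡-Reasoning

  fixed-point⇒cycle-type : InM a → Fixed σ a → ∃[ g ] ∃[ d ] (g * d ≡ suc ℓ × d ∣ q × CycleType d σ)
  fixed-point⇒cycle-type a∈M fixed with additive-order q shift
  ... | suc d′ , _ , d∣q , q∣dC , minimal = suc g′ , suc d′ , orbits*d≡n , d∣q , cycles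
    where
    cycles : CycleType (suc d′) σ
    cycles i = ∣⇒iter-fixes a∈M (Fixed⇒Shifts fixed) (suc d′) i q∣dC ,
      λ t 0<t t<d fixes → minimal t 0<t t<d (iter-fixes⇒∣ a∈M (Fixed⇒Shifts fixed) t i fixes)
    open Cycles cycles using (g′; orbits*d≡n)

-- Units modulo d

injective⇒surjective : ∀ {k} (f : Fin k → Fin k) → (∀ {x y} → f x ≡ f y → x ≡ y) → ∀ w → ∃[ s ] f s ≡ w
injective⇒surjective {suc k} f f-injective w with any? (λ s → f s ≟ᶠ w)
... | yes hit = hit
... | no miss with pigeonhole (n<1+n k) (λ s → punchOut {i = w} (λ w≡fs → miss (s , sym w≡fs)))
...   | i , j , i<j , punched≡ =
  ⊥-elim (<⇒≢ᶠ i<j (f-injective (punchOut-injective (λ w≡fi → miss (i , sym w≡fi)) (λ w≡fj → miss (j , sym w≡fj)) punched≡)))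

module _ {d : ℕ} {{_ : NonZero d}} where
  open Mod d

  private
    ∣∧<⇒≡0 : ∀ {x} → d ∣ x → x < d → x ≡ 0
    ∣∧<⇒≡0 {zero} _ _ = refl
    ∣∧<⇒≡0 {suc x} d∣x x<d = ⊥-elim (>⇒∤ x<d d∣x)

    coprime-*-cancel-≤ : ∀ {u a b} → Coprime d u → a < d → b ≤ a → a * u ≋ b * u → a ≡ b
    coprime-*-cancel-≤ {u} {a} {b} coprime a<d b≤a au≋bu = ≤-antisym (m∸n≡0⇒m≤n a∸b≡0) b≤a
      where
      d∣[a∸b]u : d ∣ u * (a ∸ b)
      d∣[a∸b]u = subst (d ∣_) (trans (sym (*-distribʳ-∸ u a b)) (*-comm (a ∸ b) u)) (≋⇒∣∸ (*-monoˡ-≤ u b≤a) au≋bu)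
      a∸b≡0 : a ∸ b ≡ 0
      a∸b≡0 = ∣∧<⇒≡0 (coprime-divisor coprime d∣[a∸b]u) (≤-<-trans (m∸n≤m a b) a<d)

  coprime-*-cancel : ∀ {u a b} → Coprime d u → a < d → b < d → a * u ≋ b * u → a ≡ b
  coprime-*-cancel {u} {a} {b} coprime a<d b<d au≋bu with ≤-total b a
  ... | inj₁ b≤a = coprime-*-cancel-≤ coprime a<d b≤a au≋bu
  ... | inj₂ a≤b = sym (coprime-*-cancel-≤ coprime b<d a≤b (sym au≋bu))

  coprime-*-surjective : ∀ {u} → Coprime d u → ∀ w → ∃[ s ] s < d × s * u ≋ w
  coprime-*-surjective {u} coprime w with injective⇒surjective times-u times-u-injective (fromℕ< (m%n<n w d))
    where
    times-u : Fin d → Fin d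
    times-u s = fromℕ< (m%n<n (toℕ s * u) d)
    times-u-injective : ∀ {x y} → times-u x ≡ times-u y → x ≡ y
    times-u-injective {x} {y} eq = toℕ-injective (coprime-*-cancel coprime (toℕ<n x) (toℕ<n y)
      (trans (sym (toℕ-fromℕ< _)) (trans (cong toℕ eq) (toℕ-fromℕ< _))))
  ... | s , su≡w = toℕ s , toℕ<n s , trans (sym (toℕ-fromℕ< _)) (trans (cong toℕ su≡w) (toℕ-fromℕ< _))

no-zero-divisor⇒coprime : ∀ {d u} {{_ : NonZero d}} → (∀ t → 0 < t → t < d → ¬ d ∣ t * u) → Coprime d u
no-zero-divisor⇒coprime {d} {u} no-zero-divisor {zero} (0∣d , _) = ⊥-elim (≢-nonZero⁻¹ d (0∣⇒≡0 0∣d))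
no-zero-divisor⇒coprime {d} {u} no-zero-divisor {suc zero} _ = refl
no-zero-divisor⇒coprime {d} {u} no-zero-divisor {i@(suc (suc _))} (i∣d , i∣u) =
  ⊥-elim (no-zero-divisor t 0<t (m/n<m d i (s≤s (s≤s z≤n))) (divides (u / i) t*u≡[u/i]*d))
  where
  t : ℕ
  t = d / i
  t*i≡d : t * i ≡ d
  t*i≡d = m/n*n≡m i∣d
  0<t : 0 < t
  0<t with t in t≡
  ... | zero = ⊥-elim (≢-nonZero⁻¹ d (trans (sym t*i≡d) (cong (_* i) t≡)))
  ... | suc _ = z<s
  t*u≡[u/i]*d : t * u ≡ u / i * d
  t*u≡[u/i]*d = begin
    t * u             ≡⟨ cong (t *_) (m/n*n≡m i∣u) ⟨
    t * (u / i * i)   ≡⟨ trans (sym (*-assoc t (u / i) i)) (trans (cong (_* i) (*-comm t (u / i))) (*-assoc (u / i) t i)) ⟩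
    u / i * (t * i)   ≡⟨ cong (u / i *_) t*i≡d ⟩
    u / i * d         ∎
    where open ≡-Reasoning

coprime-∸ : ∀ {d u} → u ≤ d → Coprime d u → Coprime d (d ∸ u)
coprime-∸ {d} {u} u≤d coprime (i∣d , i∣d∸u) =
  coprime (i∣d , ∣m+n∣m⇒∣n (subst (_ ∣_) (sym (m∸n+n≡m u≤d)) i∣d) i∣d∸u)

module _ (g′ d′ : ℕ) where

  private
    g d n : ℕ
    g = suc g′
    d = suc d′
    n = g * d

  GcdIs : ℕ → Set
  GcdIs i = (1 ≤ i × i ≤ n) × gcd n i ≡ g

  GcdIs? : Decidable GcdIs
  GcdIs? i = ((1 ≤? i) ×-dec (i ≤? n)) ×-dec (gcd n i ≟ g)

  φ-↔ : [ i ∈ ℕ ∣ GcdIs i ] ↔ Fin (φ g n)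
  φ-↔ = enumeration-↔ GcdIs?
    (filter (λ i → gcd n i ≟ g) (map suc (upTo n)))
    (Unique.filter⁺ (λ i → gcd n i ≟ g) (Unique.map⁺ suc-injective (Unique.upTo⁺ n)))
    complete sound
    where
    complete : ∀ {i} → GcdIs i → i ∈ filter (λ i → gcd n i ≟ g) (map suc (upTo n))
    complete {suc i} ((_ , i<n) , gcd≡g) = ∈-filter⁺ (λ i → gcd n i ≟ g) (∈-map⁺ suc (∈-upTo⁺ i<n)) gcd≡g
    sound : ∀ {i} → i ∈ filter (λ i → gcd n i ≟ g) (map suc (upTo n)) → GcdIs i
    sound i∈ with ∈-filter⁻ (λ i → gcd n i ≟ g) {xs = map suc (upTo n)} i∈
    ... | suc∈ , gcd≡g with ∈-map⁻ suc suc∈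
    ...   | _ , j∈ , refl = (s≤s z≤n , ∈-upTo⁻ j∈) , gcd≡g

  private
    g*[d∸u]-GcdIs : ∀ u → u < d → Coprime d u → GcdIs (g * (d ∸ u))
    g*[d∸u]-GcdIs u u<d coprime =
      (*-mono-≤ {1} {g} (s≤s z≤n) (m<n⇒0<n∸m u<d) , *-monoʳ-≤ g (m∸n≤m d u)) ,
      (begin
        gcd n (g * (d ∸ u))   ≡⟨ c*gcd[m,n]≡gcd[cm,cn] g d (d ∸ u) ⟨
        g * gcd d (d ∸ u)     ≡⟨ cong (g *_) (coprime⇒gcd≡1 (coprime-∸ (<⇒≤ u<d) coprime)) ⟩
        g * 1                 ≡⟨ *-identityʳ g ⟩
        g                     ∎)
      where open ≡-Reasoning

    module Quotient {i : ℕ} (i-GcdIs : GcdIs i) where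

      k : ℕ
      k = i / g

      g*k≡i : g * k ≡ i
      g*k≡i = m*[n/m]≡n (subst (_∣ i) (proj₂ i-GcdIs) (gcd[m,n]∣n n i))

      k≤d : k ≤ d
      k≤d = *-cancelˡ-≤ g (subst (_≤ n) (sym g*k≡i) (proj₂ (proj₁ i-GcdIs)))

      0<k : 0 < k
      0<k with k in k≡
      ... | zero = ⊥-elim (<⇒≱ (proj₁ (proj₁ i-GcdIs)) (≤-reflexive (trans (sym g*k≡i) (trans (cong (g *_) k≡) (*-zeroʳ g)))))
      ... | suc _ = z<s

      coprime-d-k : Coprime d k
      coprime-d-k = gcd≡1⇒coprime (*-cancelˡ-≡ _ 1 g (begin
        g * gcd d k       ≡⟨ c*gcd[m,n]≡gcd[cm,cn] g d k ⟩
        gcd n (g * k)     ≡⟨ cong (gcd n) g*k≡i ⟩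
        gcd n i           ≡⟨ proj₂ i-GcdIs ⟩
        g                 ≡⟨ *-identityʳ g ⟨
        g * 1             ∎))
        where open ≡-Reasoning

      d∸k<d : d ∸ k < d
      d∸k<d = ∸-monoʳ-< 0<k k≤d

  -- u ↦ g (d ∸ u) rather than g u: units lie in [0, d), 0 being one when d = 1, while φ counts i ∈ [1, n].
  units-↔ : [ u ∈ Fin d ∣ Coprime d (toℕ u) ] ↔ [ i ∈ ℕ ∣ GcdIs i ]
  units-↔ = mk↔ₛ′ to from to∘from from∘to
    where
    to : [ u ∈ Fin d ∣ Coprime d (toℕ u) ] → [ i ∈ ℕ ∣ GcdIs i ]
    to (u , [ coprime ]) = g * (d ∸ toℕ u) , [ g*[d∸u]-GcdIs (toℕ u) (toℕ<n u) coprime ]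
    from : [ i ∈ ℕ ∣ GcdIs i ] → [ u ∈ Fin d ∣ Coprime d (toℕ u) ]
    from (i , [ i-GcdIs ]) = fromℕ< (Quotient.d∸k<d i-GcdIs′) ,
      [ subst (Coprime d) (sym (toℕ-fromℕ< _)) (coprime-∸ (Quotient.k≤d i-GcdIs′) (Quotient.coprime-d-k i-GcdIs′)) ]
      where i-GcdIs′ = recompute (GcdIs? i) i-GcdIs
    to∘from : ∀ i → to (from i) ≡ i
    to∘from (i , [ i-GcdIs ]) = value-injective (begin
      g * (d ∸ toℕ (fromℕ< (d∸k<d)))   ≡⟨ cong (λ x → g * (d ∸ x)) (toℕ-fromℕ< d∸k<d) ⟩
      g * (d ∸ (d ∸ k))                ≡⟨ cong (g *_) (m∸[m∸n]≡n k≤d) ⟩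
      g * k                            ≡⟨ g*k≡i ⟩
      i                                ∎)
      where
      open ≡-Reasoning
      open Quotient (recompute (GcdIs? i) i-GcdIs)
    from∘to : ∀ u → from (to u) ≡ u
    from∘to (u , _) = value-injective (toℕ-injective (begin
      toℕ (fromℕ< _)                   ≡⟨ toℕ-fromℕ< _ ⟩
      d ∸ g * (d ∸ toℕ u) / g          ≡⟨ cong (λ x → d ∸ x / g) (*-comm g (d ∸ toℕ u)) ⟩
      d ∸ (d ∸ toℕ u) * g / g          ≡⟨ cong (d ∸_) (m*n/n≡m (d ∸ toℕ u) g) ⟩
      d ∸ (d ∸ toℕ u)                  ≡⟨ m∸[m∸n]≡n (<⇒≤ (toℕ<n u)) ⟩
      toℕ u                            ∎))
      where open ≡-Reasoning

  units-↔-φ : [ u ∈ Fin d ∣ Coprime d (toℕ u) ] ↔ Fin (φ g n)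
  units-↔-φ = ↔-trans units-↔ φ-↔

-- Starting coordinates

module Bases (d′ m′ : ℕ) where

  private
    d m q : ℕ
    d = suc d′
    m = suc m′
    q = d * m

  residue : Fin q → Fin m
  residue = Fin.remainder {d} m

  toℕ-residue : ∀ x → toℕ (residue x) ≡ toℕ x % m
  toℕ-residue x = sym (begin
    toℕ x % m                           ≡⟨ cong (λ y → toℕ y % m) (combine-remQuot {d} m x) ⟨
    toℕ (Fin.combine t s) % m               ≡⟨ cong (_% m) (toℕ-combine t s) ⟩
    (m * toℕ t + toℕ s) % m             ≡⟨ cong (_% m) (trans (+-comm (m * toℕ t) (toℕ s)) (cong (toℕ s +_) (*-comm m (toℕ t)))) ⟩
    (toℕ s + toℕ t * m) % m             ≡⟨ [m+kn]%n≡m%n (toℕ s) (toℕ t) m ⟩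
    toℕ s % m                           ≡⟨ m<n⇒m%n≡m (toℕ<n s) ⟩
    toℕ s                               ∎)
    where
    open ≡-Reasoning
    t : Fin d
    t = Fin.quotient {d} m x
    s : Fin m
    s = residue x

  Admissible : ∀ {k} → Vec (Fin q) k → Set
  Admissible b = (∀ j → toℕ (lookup b j) % m ≢ 0) × (∀ j j′ → toℕ (lookup b j) % m ≡ toℕ (lookup b j′) % m → j ≡ j′)

  Admissible? : ∀ {k} (b : Vec (Fin q) k) → Dec (Admissible b)
  Admissible? b = all? (λ j → ¬? (toℕ (lookup b j) % m ≟ 0))
    ×-dec all? (λ j → all? (λ j′ → (toℕ (lookup b j) % m ≟ toℕ (lookup b j′) % m) →-dec (j ≟ᶠ j′)))

  residues : ∀ {k} → Vec (Fin q) k → List (Fin m)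
  residues b = zero ∷ List.tabulate (residue ∘ lookup b)

  private
    residue≡⇒%≡ : ∀ x y → residue x ≡ residue y → toℕ x % m ≡ toℕ y % m
    residue≡⇒%≡ x y eq = trans (sym (toℕ-residue x)) (trans (cong toℕ eq) (toℕ-residue y))

    %≡⇒residue≡ : ∀ x y → toℕ x % m ≡ toℕ y % m → residue x ≡ residue y
    %≡⇒residue≡ x y eq = toℕ-injective (trans (toℕ-residue x) (trans eq (sym (toℕ-residue y))))

    residue≡zero⇒%≡0 : ∀ x → residue x ≡ zero → toℕ x % m ≡ 0
    residue≡zero⇒%≡0 x eq = trans (sym (toℕ-residue x)) (cong toℕ eq)

    %≡0⇒residue≡zero : ∀ x → toℕ x % m ≡ 0 → residue x ≡ zero
    %≡0⇒residue≡zero x eq = toℕ-injective (trans (toℕ-residue x) eq)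

  residues-unique : ∀ {k} {b : Vec (Fin q) k} → Admissible b → Unique (residues b)
  residues-unique {b = b} (nonzero , distinct) =
    All.tabulate zero∉ ∷ Unique.tabulate⁺ (λ {i} {j} eq → distinct i j (residue≡⇒%≡ (lookup b i) (lookup b j) eq))
    where
    zero∉ : ∀ {s} → s ∈ List.tabulate (residue ∘ lookup b) → zero ≢ s
    zero∉ s∈ zero≡s with ∈-tabulate⁻ s∈
    ... | j , refl = nonzero j (residue≡zero⇒%≡0 (lookup b j) (sym zero≡s))

  |residues| : ∀ {k} (b : Vec (Fin q) k) → length (residues b) ≡ suc k
  |residues| b = cong suc (length-tabulate (residue ∘ lookup b))

  module _ {k} {x : Fin q} {xs : Vec (Fin q) k} where

    fresh⇒∉ : toℕ x % m ≢ 0 → (∀ j → toℕ x % m ≢ toℕ (lookup xs j) % m) → residue x ∉ residues xs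
    fresh⇒∉ nonzero distinct (here eq) = nonzero (residue≡zero⇒%≡0 x eq)
    fresh⇒∉ nonzero distinct (there x∈) with ∈-tabulate⁻ x∈
    ... | j , eq = distinct j (residue≡⇒%≡ x (lookup xs j) eq)

    ∉⇒nonzero : residue x ∉ residues xs → toℕ x % m ≢ 0
    ∉⇒nonzero x∉ eq = x∉ (here (%≡0⇒residue≡zero x eq))

    ∉⇒distinct : residue x ∉ residues xs → ∀ j → toℕ x % m ≢ toℕ (lookup xs j) % m
    ∉⇒distinct x∉ j eq = x∉ (there (subst (_∈ List.tabulate (residue ∘ lookup xs)) (sym (%≡⇒residue≡ x (lookup xs j) eq)) (∈-tabulate⁺ j)))

    admissible-∷ : Admissible xs → residue x ∉ residues xs → Admissible (x ∷ xs)
    admissible-∷ (nonzero , distinct) x∉ = nonzero′ , distinct′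
      where
      nonzero′ : ∀ j → toℕ (lookup (x ∷ xs) j) % m ≢ 0
      nonzero′ zero = ∉⇒nonzero x∉
      nonzero′ (suc j) = nonzero j
      distinct′ : ∀ j j′ → toℕ (lookup (x ∷ xs) j) % m ≡ toℕ (lookup (x ∷ xs) j′) % m → j ≡ j′
      distinct′ zero zero _ = refl
      distinct′ zero (suc j′) eq = ⊥-elim (∉⇒distinct x∉ j′ eq)
      distinct′ (suc j) zero eq = ⊥-elim (∉⇒distinct x∉ j (sym eq))
      distinct′ (suc j) (suc j′) eq = cong suc (distinct j j′ eq)

    admissible-tail : Admissible (x ∷ xs) → Admissible xs
    admissible-tail (nonzero , distinct) = nonzero ∘ suc , λ j j′ eq → fsuc-injective (distinct (suc j) (suc j′) eq)

    admissible-head : Admissible (x ∷ xs) → residue x ∉ residues xs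
    admissible-head (nonzero , distinct) = fresh⇒∉ (nonzero zero) (λ j eq → zero≢suc (distinct zero (suc j) eq))
      where
      zero≢suc : ∀ {j : Fin k} → zero ≢ suc j
      zero≢suc ()

  fresh-↔ : (S : List (Fin m)) → [ x ∈ Fin q ∣ residue x ∉ S ] ↔ (Fin d × [ s ∈ Fin m ∣ s ∉ S ])
  fresh-↔ S = mk↔ₛ′ to from to∘from from∘to
    where
    to : [ x ∈ Fin q ∣ residue x ∉ S ] → Fin d × [ s ∈ Fin m ∣ s ∉ S ]
    to (x , [ x∉S ]) = Fin.quotient {d} m x , (residue x , [ x∉S ])
    from : Fin d × [ s ∈ Fin m ∣ s ∉ S ] → [ x ∈ Fin q ∣ residue x ∉ S ]
    from (t , (s , [ s∉S ])) = Fin.combine t s , [ subst (_∉ S) (sym (cong proj₂ (remQuot-combine t s))) s∉S ]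
    to∘from : ∀ ts → to (from ts) ≡ ts
    to∘from (t , (s , _)) = cong₂ _,_ (cong proj₁ (remQuot-combine t s)) (value-injective (cong proj₂ (remQuot-combine t s)))
    from∘to : ∀ x → from (to x) ≡ x
    from∘to (x , _) = value-injective (combine-remQuot {d} m x)

  Extensions : ℕ → Set
  Extensions k = Σ [ xs ∈ Vec (Fin q) k ∣ Admissible xs ] (λ xs → [ x ∈ Fin q ∣ residue x ∉ residues (value xs) ])

  admissible-∷-↔ : ∀ k → [ v ∈ Vec (Fin q) (suc k) ∣ Admissible v ] ↔ Extensions k
  admissible-∷-↔ k = mk↔ₛ′ to from (λ _ → refl) (λ { ((_ ∷ _) , _) → refl })
    where
    to : [ v ∈ Vec (Fin q) (suc k) ∣ Admissible v ] → Extensions k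
    to ((x ∷ xs) , [ adm ]) = (xs , [ admissible-tail adm ]) , (x , [ admissible-head adm ])
    from : Extensions k → [ v ∈ Vec (Fin q) (suc k) ∣ Admissible v ]
    from ((xs , [ adm ]) , (x , [ x∉ ])) = (x ∷ xs) , [ admissible-∷ adm x∉ ]

  admissibleCount : ℕ → ℕ
  admissibleCount zero = 1
  admissibleCount (suc k) = admissibleCount k * (d * (m ∸ suc k))

  admissible-↔ : ∀ k → [ b ∈ Vec (Fin q) k ∣ Admissible b ] ↔ Fin (admissibleCount k)
  admissible-↔ zero = mk↔ₛ′ (λ _ → zero) (λ _ → [] , [ (λ ()) , (λ ()) ]) (λ { zero → refl }) (λ { ([] , _) → refl })
  admissible-↔ (suc k) = ↔-trans (admissible-∷-↔ k) (↔-trans (Σ-↔ (admissible-↔ k) (λ {xs} → fresh-count xs)) (↔-sym *↔×))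
    where
    fresh-count : (xs : [ b ∈ Vec (Fin q) k ∣ Admissible b ]) → [ x ∈ Fin q ∣ residue x ∉ residues (value xs) ] ↔ Fin (d * (m ∸ suc k))
    fresh-count xs = ↔-trans (fresh-↔ (residues (value xs))) (↔-trans (↔-refl ×-↔ unused-residues) (↔-sym *↔×))
      where
      unused-residues : [ s ∈ Fin m ∣ s ∉ residues (value xs) ] ↔ Fin (m ∸ suc k)
      unused-residues = subst (λ l → [ s ∈ Fin m ∣ s ∉ residues (value xs) ] ↔ Fin (m ∸ l)) (|residues| (value xs))
        (complement-↔ (residues (value xs)) (residues-unique {b = value xs} (recomputed Admissible? xs)))

  admissibleCount≡0 : ∀ k → m ≤ k → admissibleCount k ≡ 0
  admissibleCount≡0 (suc k) m≤k+1 with m≤n⇒m<n∨m≡n m≤k+1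
  ... | inj₁ m<k+1 = cong (_* (d * (m ∸ suc k))) (admissibleCount≡0 k (s≤s⁻¹ m<k+1))
  ... | inj₂ refl = trans (cong (λ x → admissibleCount k * (d * x)) (n∸n≡0 (suc k))) (trans (cong (admissibleCount k *_) (*-zeroʳ d)) (*-zeroʳ (admissibleCount k)))

  d*[m∸j]≡q-j*d : ∀ {j} → j ≤ m → ℤ.+ (d * (m ∸ j)) ≡ ℤ.+ q ℤ.- ℤ.+ (j * d)
  d*[m∸j]≡q-j*d {j} j≤m = begin
    ℤ.+ (d * (m ∸ j))        ≡⟨ cong ℤ.+_ (trans (*-distribˡ-∸ d m j) (cong (q ∸_) (*-comm d j))) ⟩
    ℤ.+ (q ∸ j * d)          ≡⟨ ℤ.⊖-≥ (subst (_≤ q) (*-comm d j) (*-monoʳ-≤ d j≤m)) ⟨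
    q ℤ.⊖ j * d              ≡⟨ ℤ.[+m]-[+n]≡m⊖n q (j * d) ⟨
    ℤ.+ q ℤ.- ℤ.+ (j * d)    ∎
    where open ≡-Reasoning

  admissibleCount≡fallProd : ∀ k → ℤ.+ admissibleCount k ≡ fallProd q d k
  admissibleCount≡fallProd zero = refl
  admissibleCount≡fallProd (suc k) with suc k ≤? m
  ... | yes k+1≤m = trans (ℤ.pos-* (admissibleCount k) _) (cong₂ ℤ._*_ (admissibleCount≡fallProd k) (d*[m∸j]≡q-j*d k+1≤m))
  ... | no k+1≰m = begin
    ℤ.+ admissibleCount (suc k)                              ≡⟨ cong ℤ.+_ (admissibleCount≡0 (suc k) m≤k+1) ⟩
    ℤ.+ 0 ℤ.* (ℤ.+ q ℤ.- ℤ.+ (suc k * d))                    ≡⟨ cong (λ x → ℤ.+ x ℤ.* (ℤ.+ q ℤ.- ℤ.+ (suc k * d))) (admissibleCount≡0 k (s≤s⁻¹ (≰⇒> k+1≰m))) ⟨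
    ℤ.+ admissibleCount k ℤ.* (ℤ.+ q ℤ.- ℤ.+ (suc k * d))    ≡⟨ cong (ℤ._* (ℤ.+ q ℤ.- ℤ.+ (suc k * d))) (admissibleCount≡fallProd k) ⟩
    fallProd q d (suc k)                                     ∎
    where
    open ≡-Reasoning
    m≤k+1 : m ≤ suc k
    m≤k+1 = <⇒≤ (≰⇒> k+1≰m)

-- Fixed points in M(A;q) as units and starting coordinates

coord-lookup : ∀ {ℓ q} (v : Vec (Fin (suc q)) ℓ) k → coord (lookup v) k ≡ toℕ (lookup (zero ∷ v) k)
coord-lookup v zero = refl
coord-lookup v (suc i) = refl

coord<q : ∀ {ℓ q} (v : Vec (Fin (suc q)) ℓ) k → coord (lookup v) k < suc q
coord<q v k = subst (_< _) (sym (coord-lookup v k)) (toℕ<n (lookup (zero ∷ v) k))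

module FixedPointDecomposition {ℓ d′ m′ : ℕ} {σ : Permutation′ (suc ℓ)} (cycles : CycleType (suc d′) σ) where

  private
    d m q : ℕ
    d = suc d′
    m = suc m′
    q = d * m

  open Mod q
  open Cycles cycles
  open Bases d′ m′

  base : Vec (Fin q) g′ → Fin (suc g′) → ℕ
  base b J = toℕ (lookup (zero ∷ b) J)

  -- The coordinate at σ^p (root J) is b_J + p m u, where b_0 = 0 because the coordinate of e_1 is 0.
  assemble : ℕ → Vec (Fin q) g′ → Fin (suc ℓ) → ℕ
  assemble u b k = base b (orbit-index k) + toℕ (position k) * (m * u)

  point : ℕ → Vec (Fin q) g′ → Vec (Fin q) ℓ
  point u b = tabulate (λ i → fromℕ< (m%n<n (assemble u b (suc i)) q))

  assemble-zero : ∀ u b → assemble u b zero ≡ 0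
  assemble-zero u b = cong₂ (λ J p → base b J + p * (m * u)) orbit-index-zero position-zero

  coord-point : ∀ u b k → coord (lookup (point u b)) k ≡ assemble u b k % q
  coord-point u b zero = sym (trans (cong (_% q) (assemble-zero u b)) 0%q≡0)
  coord-point u b (suc i) = trans (cong toℕ (lookup∘tabulate _ i)) (toℕ-fromℕ< _)

  position-mod : ∀ t x → t % d * (m * x) ≋ t * (m * x)
  position-mod t x = sym (begin
    t * (m * x) % q                                  ≡⟨ cong (λ s → s * (m * x) % q) (m≡m%n+[m/n]*n t d) ⟩
    (t % d + t / d * d) * (m * x) % q                ≡⟨ cong (_% q) (expand (t % d) (t / d) x d m) ⟩
    (t % d * (m * x) + t / d * x * q) % q            ≡⟨ [m+kn]%n≡m%n (t % d * (m * x)) (t / d * x) q ⟩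
    t % d * (m * x) % q                              ∎)
    where
    open ≡-Reasoning
    expand : ∀ a c x d m → (a + c * d) * (m * x) ≡ a * (m * x) + c * x * (d * m)
    expand = solve-∀

  assemble-σ : ∀ u b j → assemble u b (σ ⟨$⟩ʳ j) ≋ assemble u b j + m * u
  assemble-σ u b j = begin
    (base b (orbit-index (σ ⟨$⟩ʳ j)) + toℕ (position (σ ⟨$⟩ʳ j)) * (m * u)) % q
      ≡⟨ cong₂ (λ J p → (base b J + p * (m * u)) % q) (orbit-index-iter 1 j) (position-σ j) ⟩
    (base b (orbit-index j) + suc (toℕ (position j)) % d * (m * u)) % q
      ≡⟨ ≋-+ {base b (orbit-index j)} {base b (orbit-index j)} {suc (toℕ (position j)) % d * (m * u)} {suc (toℕ (position j)) * (m * u)}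
           refl (position-mod (suc (toℕ (position j))) u) ⟩
    (base b (orbit-index j) + suc (toℕ (position j)) * (m * u)) % q
      ≡⟨ cong (_% q) (rearrange (base b (orbit-index j)) (toℕ (position j)) (m * u)) ⟩
    (assemble u b j + m * u) % q ∎
    where
    open ≡-Reasoning
    rearrange : ∀ B p x → B + suc p * x ≡ B + p * x + x
    rearrange = solve-∀

  module _ {u : ℕ} (u<d : u < d) (b : Vec (Fin q) g′) where
    open Shift σ (lookup (point u b))

    mu<q : m * u < q
    mu<q = subst (_< q) (*-comm u m) (*-monoˡ-< m u<d)

    shift-point : shift ≡ m * u
    shift-point = begin
      coord (lookup (point u b)) (σ ⟨$⟩ʳ zero) ≡⟨ coord-point u b (σ ⟨$⟩ʳ zero) ⟩
      assemble u b (σ ⟨$⟩ʳ zero) % q           ≡⟨ assemble-σ u b zero ⟩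
      (assemble u b zero + m * u) % q          ≡⟨ cong (λ x → (x + m * u) % q) (assemble-zero u b) ⟩
      m * u % q                                ≡⟨ m<n⇒m%n≡m mu<q ⟩
      m * u                                    ∎
      where open ≡-Reasoning

    point-Shifts : Shifts
    point-Shifts j = begin
      coord (lookup (point u b)) (σ ⟨$⟩ʳ j) % q               ≡⟨ cong (_% q) (coord-point u b (σ ⟨$⟩ʳ j)) ⟩
      assemble u b (σ ⟨$⟩ʳ j) % q % q                         ≡⟨ m%n%n≡m%n (assemble u b (σ ⟨$⟩ʳ j)) q ⟩
      assemble u b (σ ⟨$⟩ʳ j) % q                             ≡⟨ assemble-σ u b j ⟩
      (assemble u b j + m * u) % q                            ≡⟨ ≋-+ {assemble u b j} {assemble u b j % q} {m * u} {m * u} (sym (m%n%n≡m%n (assemble u b j) q)) refl ⟩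
      (assemble u b j % q + m * u) % q                        ≡⟨ cong₂ (λ x y → (x + y) % q) (sym (coord-point u b j)) (sym shift-point) ⟩
      (coord (lookup (point u b)) j + shift) % q              ∎
      where open ≡-Reasoning

  base-injective : ∀ {b} → Admissible b → ∀ J J′ → base b J % m ≡ base b J′ % m → J ≡ J′
  base-injective adm zero zero _ = refl
  base-injective adm zero (suc j′) eq = ⊥-elim (proj₁ adm j′ (sym eq))
  base-injective adm (suc j) zero eq = ⊥-elim (proj₁ adm j eq)
  base-injective adm (suc j) (suc j′) eq = cong suc (proj₂ adm j j′ eq)

  private
    p*[m*u]≡p*u*m : ∀ p u → p * (m * u) ≡ p * u * m
    p*[m*u]≡p*u*m p u = trans (cong (p *_) (*-comm m u)) (sym (*-assoc p u m))

  assemble-%m : ∀ u b k → assemble u b k % m ≡ base b (orbit-index k) % m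
  assemble-%m u b k = trans (cong (λ x → (base b (orbit-index k) + x) % m) (p*[m*u]≡p*u*m (toℕ (position k)) u))
    ([m+kn]%n≡m%n (base b (orbit-index k)) (toℕ (position k) * u) m)

  assemble-injective : ∀ {u b} → Coprime d u → Admissible b → ∀ k k′ → assemble u b k ≋ assemble u b k′ → k ≡ k′
  assemble-injective {u} {b} coprime adm k k′ eq = begin
    k                                                  ≡⟨ iter-position-root k ⟨
    iter σ (toℕ (position k)) (root (orbit-index k))   ≡⟨ cong₂ (λ t J → iter σ t (root J)) same-position same-orbit ⟩
    iter σ (toℕ (position k′)) (root (orbit-index k′)) ≡⟨ iter-position-root k′ ⟩
    k′                                                 ∎
    where
    open ≡-Reasoning
    p p′ : ℕ
    p = toℕ (position k)
    p′ = toℕ (position k′)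
    %q⇒%m : ∀ x y → x % q ≡ y % q → x % m ≡ y % m
    %q⇒%m x y x≋y = trans (sym (m∣n⇒o%n%m≡o%m m q x (n∣m*n d))) (trans (cong (_% m) x≋y) (m∣n⇒o%n%m≡o%m m q y (n∣m*n d)))
    same-orbit : orbit-index k ≡ orbit-index k′
    same-orbit = base-injective adm _ _
      (trans (sym (assemble-%m u b k)) (trans (%q⇒%m (assemble u b k) (assemble u b k′) eq) (assemble-%m u b k′)))
    same-offset : p * (m * u) ≋ p′ * (m * u)
    same-offset = ≋-cancelˡ (base b (orbit-index k))
      (trans eq (cong (λ J → (base b J + p′ * (m * u)) % q) (sym same-orbit)))
    same-residue : p * u % d * m ≡ p′ * u % d * m
    same-residue = begin
      p * u % d * m         ≡⟨ m%n*o≡m*o%[n*o] (p * u) d m ⟩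
      p * u * m % q         ≡⟨ cong (_% q) (p*[m*u]≡p*u*m p u) ⟨
      p * (m * u) % q       ≡⟨ same-offset ⟩
      p′ * (m * u) % q      ≡⟨ cong (_% q) (p*[m*u]≡p*u*m p′ u) ⟩
      p′ * u * m % q        ≡⟨ m%n*o≡m*o%[n*o] (p′ * u) d m ⟨
      p′ * u % d * m        ∎
    same-position : p ≡ p′
    same-position = coprime-*-cancel coprime (toℕ<n (position k)) (toℕ<n (position k′)) (*-cancelʳ-≡ _ _ m same-residue)

  point-InM : ∀ {u b} → Coprime d u → Admissible b → InM (lookup (point u b))
  point-InM {u} {b} coprime adm i j i≢j i≡j = i≢j (assemble-injective coprime adm i j (begin
    assemble u b i % q                 ≡⟨ m%n%n≡m%n (assemble u b i) q ⟨
    assemble u b i % q % q             ≡⟨ cong (_% q) (coord-point u b i) ⟨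
    coord (lookup (point u b)) i % q   ≡⟨ [mod]⇒≋ {coord (lookup (point u b)) i} {coord (lookup (point u b)) j} i≡j ⟩
    coord (lookup (point u b)) j % q   ≡⟨ cong (_% q) (coord-point u b j) ⟩
    assemble u b j % q % q             ≡⟨ m%n%n≡m%n (assemble u b j) q ⟩
    assemble u b j % q                 ∎))
    where open ≡-Reasoning

  module Decompose (v : Vec (Fin q) ℓ) where
    open Shift σ (lookup v)

    private
      A : Fin (suc ℓ) → ℕ
      A = coord (lookup v)

    unit : ℕ
    unit = shift / m

    unit<d : unit < d
    unit<d = m<n*o⇒m/o<n (coord<q v (σ ⟨$⟩ʳ zero))

    bases : Vec (Fin q) g′
    bases = tabulate (λ j → lookup (zero ∷ v) (root (suc j)))

    base-bases : ∀ J → base bases J ≡ A (root J)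
    base-bases zero = sym (cong A root-zero)
    base-bases (suc j) = trans (cong toℕ (lookup∘tabulate _ j)) (sym (coord-lookup v (root (suc j))))

    module _ (v∈M : InM (lookup v)) (fixed : Fixed σ (lookup v)) where

      private
        shifts : Shifts
        shifts = Fixed⇒Shifts fixed

      shift≡unit*m : shift ≡ unit * m
      shift≡unit*m = sym (m/n*n≡m (*-cancelˡ-∣ d (iter-fixes⇒∣ v∈M shifts d zero (proj₁ (cycles zero)))))

      unit-coprime : Coprime d unit
      unit-coprime = no-zero-divisor⇒coprime λ t 0<t t<d d∣tu → proj₂ (cycles zero) t 0<t t<d
        (∣⇒iter-fixes v∈M shifts t zero (subst (q ∣_) (sym (t*shift≡t*unit*m t)) (*-monoˡ-∣ m d∣tu)))
        where
        t*shift≡t*unit*m : ∀ t → t * shift ≡ t * unit * m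
        t*shift≡t*unit*m t = trans (cong (t *_) shift≡unit*m) (sym (*-assoc t unit m))

      private
        -- A difference w m of coordinates is ≡ s c modulo q for some s, because u is invertible modulo d.
        same-orbit-≤ : ∀ x y → A y ≤ A x → A x % m ≡ A y % m → orbit-index x ≡ orbit-index y
        same-orbit-≤ x y Ay≤Ax eq = by-multiple (Mod.≋⇒∣∸ m Ay≤Ax eq)
          where
          by-solution : ∀ w → A x ∸ A y ≡ w * m → (∃[ s ] s < d × s * unit % d ≡ w % d) → orbit-index x ≡ orbit-index y
          by-solution w Ax∸Ay≡w*m (s , _ , su≋w) = trans (cong orbit-index (sym iter-s-y≡x)) (orbit-index-iter s y)
            where
            s*shift≋w*m : s * shift ≋ w * m
            s*shift≋w*m = begin
              s * shift % q       ≡⟨ cong (λ c → s * c % q) shift≡unit*m ⟩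
              s * (unit * m) % q  ≡⟨ cong (_% q) (*-assoc s unit m) ⟨
              s * unit * m % q    ≡⟨ m%n*o≡m*o%[n*o] (s * unit) d m ⟨
              s * unit % d * m    ≡⟨ cong (_* m) su≋w ⟩
              w % d * m           ≡⟨ m%n*o≡m*o%[n*o] w d m ⟩
              w * m % q           ∎
              where open ≡-Reasoning
            iter-s-y≡x : iter σ s y ≡ x
            iter-s-y≡x = InM⇒coord-injective v∈M _ _ (begin
              A (iter σ s y) % q      ≡⟨ iter-Shifts shifts s y ⟩
              (A y + s * shift) % q   ≡⟨ ≋-+ {A y} {A y} {s * shift} {w * m} refl s*shift≋w*m ⟩
              (A y + w * m) % q       ≡⟨ cong (λ z → (A y + z) % q) (sym Ax∸Ay≡w*m) ⟩
              (A y + (A x ∸ A y)) % q ≡⟨ cong (_% q) (m+[n∸m]≡n Ay≤Ax) ⟩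
              A x % q                 ∎)
              where open ≡-Reasoning
          by-multiple : m ∣ A x ∸ A y → orbit-index x ≡ orbit-index y
          by-multiple (divides w Ax∸Ay≡w*m) = by-solution w Ax∸Ay≡w*m (coprime-*-surjective unit-coprime w)

      same-orbit : ∀ x y → A x % m ≡ A y % m → orbit-index x ≡ orbit-index y
      same-orbit x y eq with ≤-total (A y) (A x)
      ... | inj₁ Ay≤Ax = same-orbit-≤ x y Ay≤Ax eq
      ... | inj₂ Ax≤Ay = sym (same-orbit-≤ y x Ax≤Ay (sym eq))

      bases-admissible : Admissible bases
      bases-admissible = (λ j eq → suc≢zero (residue-injective (suc j) zero eq))
                       , (λ j j′ eq → fsuc-injective (residue-injective (suc j) (suc j′) eq))
        where
        suc≢zero : ∀ {j : Fin g′} → suc j ≢ zero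
        suc≢zero ()
        residue-injective : ∀ J J′ → base bases J % m ≡ base bases J′ % m → J ≡ J′
        residue-injective J J′ eq = begin
          J                     ≡⟨ orbit-index-root J ⟨
          orbit-index (root J)  ≡⟨ same-orbit (root J) (root J′) (subst₂ (λ x y → x % m ≡ y % m) (base-bases J) (base-bases J′) eq) ⟩
          orbit-index (root J′) ≡⟨ orbit-index-root J′ ⟩
          J′                    ∎
          where open ≡-Reasoning

      reassemble : ∀ k → assemble unit bases k % q ≡ A k
      reassemble k = begin
        (base bases (orbit-index k) + toℕ (position k) * (m * unit)) % q
          ≡⟨ cong₂ (λ x c → (x + toℕ (position k) * c) % q) (base-bases (orbit-index k)) (trans (*-comm m unit) (sym shift≡unit*m)) ⟩
        (A (root (orbit-index k)) + toℕ (position k) * shift) % q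
          ≡⟨ iter-Shifts shifts (toℕ (position k)) (root (orbit-index k)) ⟨
        A (iter σ (toℕ (position k)) (root (orbit-index k))) % q
          ≡⟨ cong (λ x → A x % q) (iter-position-root k) ⟩
        A k % q
          ≡⟨ m<n⇒m%n≡m (coord<q v k) ⟩
        A k ∎
        where open ≡-Reasoning

  fixed-points-↔ : [ v ∈ Vec (Fin q) ℓ ∣ FixedInM σ v ] ↔
                   ([ u ∈ Fin d ∣ Coprime d (toℕ u) ] × [ b ∈ Vec (Fin q) g′ ∣ Admissible b ])
  fixed-points-↔ = mk↔ₛ′ to from to∘from from∘to
    where
    open Decompose
    to : [ v ∈ Vec (Fin q) ℓ ∣ FixedInM σ v ] → [ u ∈ Fin d ∣ Coprime d (toℕ u) ] × [ b ∈ Vec (Fin q) g′ ∣ Admissible b ]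
    to (v , [ v∈M×fixed ]) = (fromℕ< (unit<d v) , [ subst (Coprime d) (sym (toℕ-fromℕ< _)) (unit-coprime v (proj₁ v∈M×fixed) (proj₂ v∈M×fixed)) ])
                           , (bases v , [ bases-admissible v (proj₁ v∈M×fixed) (proj₂ v∈M×fixed) ])
    from : [ u ∈ Fin d ∣ Coprime d (toℕ u) ] × [ b ∈ Vec (Fin q) g′ ∣ Admissible b ] → [ v ∈ Vec (Fin q) ℓ ∣ FixedInM σ v ]
    from ((u , [ coprime ]) , (b , [ adm ])) =
      point (toℕ u) b , [ point-InM coprime adm , Shift.Shifts⇒Fixed σ (lookup (point (toℕ u) b)) (point-Shifts (toℕ<n u) b) ]
    to∘from : ∀ ub → to (from ub) ≡ ub
    to∘from ((u , _) , (b , _)) = cong₂ _,_ (value-injective (toℕ-injective (trans (toℕ-fromℕ< _) unit-point)))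
                                            (value-injective (trans (tabulate-cong bases-point) (tabulate∘lookup b)))
      where
      unit-point : unit (point (toℕ u) b) ≡ toℕ u
      unit-point = trans (cong (_/ m) (trans (shift-point (toℕ<n u) b) (*-comm m (toℕ u)))) (m*n/n≡m (toℕ u) m)
      bases-point : ∀ j → lookup (zero ∷ point (toℕ u) b) (root (suc j)) ≡ lookup b j
      bases-point j = toℕ-injective (begin
        toℕ (lookup (zero ∷ point (toℕ u) b) (root (suc j)))  ≡⟨ coord-lookup (point (toℕ u) b) (root (suc j)) ⟨
        coord (lookup (point (toℕ u) b)) (root (suc j))        ≡⟨ coord-point (toℕ u) b (root (suc j)) ⟩
        assemble (toℕ u) b (root (suc j)) % q                  ≡⟨ cong₂ (λ J t → (base b J + t * (m * toℕ u)) % q) (orbit-index-root (suc j)) (position-root (suc j)) ⟩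
        (toℕ (lookup b j) + 0) % q                             ≡⟨ cong (_% q) (+-identityʳ (toℕ (lookup b j))) ⟩
        toℕ (lookup b j) % q                                   ≡⟨ m<n⇒m%n≡m (toℕ<n (lookup b j)) ⟩
        toℕ (lookup b j)                                       ∎)
        where open ≡-Reasoning
    from∘to : ∀ v → from (to v) ≡ v
    from∘to x@(v , _) = value-injective (trans (tabulate-cong (λ i → toℕ-injective (begin
      toℕ (fromℕ< (m%n<n (assemble (toℕ (fromℕ< (unit<d v))) (bases v) (suc i)) q)) ≡⟨ toℕ-fromℕ< _ ⟩
      assemble (toℕ (fromℕ< (unit<d v))) (bases v) (suc i) % q ≡⟨ cong (λ u → assemble u (bases v) (suc i) % q) (toℕ-fromℕ< (unit<d v)) ⟩
      assemble (unit v) (bases v) (suc i) % q                  ≡⟨ reassemble v v∈M fixed (suc i) ⟩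
      toℕ (lookup v i)                                         ∎))) (tabulate∘lookup v))
      where
      open ≡-Reasoning
      v∈M : InM (lookup v)
      v∈M = proj₁ (recomputed (FixedInM? σ) x)
      fixed : Fixed σ (lookup v)
      fixed = proj₂ (recomputed (FixedInM? σ) x)

-- The formula for χ

χ-vanishes : ∀ {ℓ} (σ : Permutation′ (suc ℓ)) q → 0 < q →
             ¬ (∃[ g ] ∃[ d ] (g * d ≡ suc ℓ × d ∣ q × CycleType d σ)) → χ ℓ q σ ≡ 0
χ-vanishes {ℓ} σ q 0<q no-cycle-type = ↔-Fin-empty no-fixed-point (χ-↔ σ)
  where
  instance
    q≢0 : NonZero q
    q≢0 = >-nonZero 0<q
  no-fixed-point : ¬ [ v ∈ Vec (Fin q) ℓ ∣ FixedInM σ v ]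
  no-fixed-point x = no-cycle-type (Shift.fixed-point⇒cycle-type σ (lookup (value x))
    (proj₁ (recomputed (FixedInM? σ) x)) (proj₂ (recomputed (FixedInM? σ) x)))

χ≡φ*admissibleCount : ∀ {ℓ d′ m′} {σ : Permutation′ (suc ℓ)} (cycles : CycleType (suc d′) σ) →
  let open Cycles cycles using (g′) in
  χ ℓ (suc d′ * suc m′) σ ≡ φ (suc g′) (suc g′ * suc d′) * Bases.admissibleCount d′ m′ g′
χ≡φ*admissibleCount {ℓ} {d′} {m′} {σ} cycles = ↔⇒≡ (↔-trans (↔-sym (χ-↔ σ))
  (↔-trans (FixedPointDecomposition.fixed-points-↔ {m′ = m′} cycles)
  (↔-trans ((units-↔-φ g′ d′) ×-↔ (Bases.admissible-↔ d′ m′ g′)) (↔-sym *↔×))))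
  where open Cycles cycles using (g′)

χ-formula : ∀ {ℓ} (σ : Permutation′ (suc ℓ)) q → 0 < q → ∀ g d → g * d ≡ suc ℓ → d ∣ q → CycleType d σ →
            ℤ.+ χ ℓ q σ ≡ ℤ.+ φ g (suc ℓ) ℤ.* fallProd q d (g ∸ 1)
χ-formula σ q 0<q zero d () d∣q cycles
χ-formula σ q 0<q (suc g₀) zero g*0≡n d∣q cycles = ⊥-elim (0≢1+n (trans (sym (*-zeroʳ (suc g₀))) g*0≡n))
χ-formula σ q 0<q (suc g₀) (suc d′) g*d≡n (divides zero q≡0) cycles = ⊥-elim (<⇒≢ 0<q (sym q≡0))
χ-formula {ℓ} σ q 0<q (suc g₀) (suc d′) g*d≡n (divides (suc m′) q≡m*d) cycles =
  subst (λ q → ℤ.+ χ ℓ q σ ≡ ℤ.+ φ (suc g₀) (suc ℓ) ℤ.* fallProd q d g₀) (sym (trans q≡m*d (*-comm m d))) (begin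
    ℤ.+ χ ℓ (d * m) σ                                           ≡⟨ cong ℤ.+_ (χ≡φ*admissibleCount cycles) ⟩
    ℤ.+ (φ (suc g′) (suc g′ * d) * admissibleCount g′)          ≡⟨ ℤ.pos-* (φ (suc g′) (suc g′ * d)) (admissibleCount g′) ⟩
    ℤ.+ φ (suc g′) (suc g′ * d) ℤ.* ℤ.+ admissibleCount g′      ≡⟨ cong₂ (λ n k → ℤ.+ φ (suc g′) n ℤ.* k) orbits*d≡n (admissibleCount≡fallProd g′) ⟩
    ℤ.+ φ (suc g′) (suc ℓ) ℤ.* fallProd (d * m) d g′            ≡⟨ cong (λ g → ℤ.+ φ (suc g) (suc ℓ) ℤ.* fallProd (d * m) d g) g′≡g₀ ⟩
    ℤ.+ φ (suc g₀) (suc ℓ) ℤ.* fallProd (d * m) d g₀            ∎)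
  where
  open ≡-Reasoning
  open Cycles cycles using (g′; orbits*d≡n)
  open Bases d′ m′ using (admissibleCount; admissibleCount≡fallProd)
  d m : ℕ
  d = suc d′
  m = suc m′
  g′≡g₀ : g′ ≡ g₀
  g′≡g₀ = suc-injective (*-cancelʳ-≡ (suc g′) (suc g₀) d (trans orbits*d≡n (sym g*d≡n)))

-- Quasi-polynomiality with period ℓ + 1

CycleType? : ∀ {n} d (σ : Permutation′ n) → Dec (CycleType d σ)
CycleType? {n} d σ with all? (λ i → (iter σ d i ≟ᶠ i) ×-dec all? (λ (k : Fin d) → (0 <? toℕ k) →-dec ¬? (iter σ (toℕ k) i ≟ᶠ i)))
... | yes cycles = yes λ i → proj₁ (cycles i) , λ k 0<k k<d →
  subst (λ t → iter σ t i ≢ i) (toℕ-fromℕ< k<d) (proj₂ (cycles i) (fromℕ< k<d) (subst (0 <_) (sym (toℕ-fromℕ< k<d)) 0<k))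
... | no ¬cycles = no λ cycles → ¬cycles λ i → proj₁ (cycles i) , λ k 0<k → proj₂ (cycles i) (toℕ k) 0<k (toℕ<n k)

module _ (ℓ : ℕ) where

  private
    n : ℕ
    n = suc ℓ

  Candidate : ℕ → Permutation′ n → ℕ → Set
  Candidate r σ d = 0 < d × d ∣ n × d ∣ r × CycleType d σ

  candidate? : ∀ r σ → Dec (∃[ i ] Candidate r σ (toℕ {suc n} i))
  candidate? r σ = any? λ i → (0 <? toℕ i) ×-dec ((toℕ i ∣? n) ×-dec ((toℕ i ∣? r) ×-dec CycleType? (toℕ i) σ))

  χ-poly : ∀ {r σ} → Dec (∃[ i ] Candidate r σ (toℕ {suc n} i)) → List ℚ
  χ-poly (yes (i , _ , divides g _ , _)) = scale (toℚ (ℤ.+ φ g n)) (fallProdPoly (toℕ i) (g ∸ 1))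
  χ-poly (no _) = []

  χ-poly-correct : ∀ {r σ} q → 0 < q → q ≡ r [mod n ] → (c : Dec (∃[ i ] Candidate r σ (toℕ {suc n} i))) →
                   toℚ (ℤ.+ χ ℓ q σ) ≡ evalPoly (χ-poly c) q
  χ-poly-correct {r} {σ} q 0<q q≡r (yes (i , 0<d , divides g n≡g*d , d∣r , cycles)) =
    trans (cong toℚ (χ-formula σ q 0<q g (toℕ i) (sym n≡g*d) d∣q cycles)) (sym (evalPoly-scale-fallProdPoly q (φ g n) (toℕ i) (g ∸ 1)))
    where
    instance
      d≢0 : NonZero (toℕ i)
      d≢0 = >-nonZero 0<d
    d∣q : toℕ i ∣ q
    d∣q = Mod.≋-∣ n (divides g n≡g*d) (Mod.[mod]⇒≋ n {q} {r} q≡r) d∣r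
  χ-poly-correct {r} {σ} q 0<q q≡r (no no-candidate) = cong (toℚ ∘ ℤ.+_) (χ-vanishes σ q 0<q no-cycle-type)
    where
    no-cycle-type : ¬ (∃[ g ] ∃[ d ] (g * d ≡ n × d ∣ q × CycleType d σ))
    no-cycle-type (g , zero , g*0≡n , _) = 0≢1+n (trans (sym (*-zeroʳ g)) g*0≡n)
    no-cycle-type (g , d@(suc _) , g*d≡n , d∣q , cycles) = no-candidate (fromℕ< d<n+1 ,
      subst (Candidate r σ) (sym (toℕ-fromℕ< d<n+1)) (z<s , d∣n , Mod.≋-∣ n d∣n (sym (Mod.[mod]⇒≋ n {q} {r} q≡r)) d∣q , cycles))
      where
      d∣n : d ∣ n
      d∣n = divides g (sym g*d≡n)
      d<n+1 : d < suc n
      d<n+1 = s≤s (∣⇒≤ d∣n)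

  period : IsPeriod ℓ n
  period = z<s , λ r → (λ σ → χ-poly (candidate? r σ)) , λ q 0<q q≡r σ → χ-poly-correct q 0<q q≡r (candidate? r σ)

-- Minimality of the period

module Rotation (ℓ : ℕ) where

  private
    n : ℕ
    n = suc ℓ

  open Mod n

  private
    next prev : Fin n → Fin n
    next i = fromℕ< (m%n<n (suc (toℕ i)) n)
    prev i = fromℕ< (m%n<n (toℕ i + ℓ) n)

    suc[x]+ℓ≋x : ∀ x → suc x + ℓ ≋ x
    suc[x]+ℓ≋x x = trans (cong (_% n) (trans (sym (+-suc x ℓ)) (cong (x +_) (sym (*-identityˡ n))))) ([m+kn]%n≡m%n x 1 n)

    prev∘next : ∀ i → prev (next i) ≡ i
    prev∘next i = toℕ-injective (begin
      toℕ (prev (next i))                  ≡⟨ toℕ-fromℕ< (m%n<n (toℕ (next i) + ℓ) n) ⟩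
      (toℕ (next i) + ℓ) % n               ≡⟨ cong (λ x → (x + ℓ) % n) (toℕ-fromℕ< (m%n<n (suc (toℕ i)) n)) ⟩
      (suc (toℕ i) % n + ℓ) % n            ≡⟨ ≋-+ {suc (toℕ i) % n} {suc (toℕ i)} {ℓ} {ℓ} (m%n%n≡m%n (suc (toℕ i)) n) refl ⟩
      (suc (toℕ i) + ℓ) % n                ≡⟨ suc[x]+ℓ≋x (toℕ i) ⟩
      toℕ i % n                            ≡⟨ m<n⇒m%n≡m (toℕ<n i) ⟩
      toℕ i                                ∎)
      where open ≡-Reasoning

    next∘prev : ∀ i → next (prev i) ≡ i
    next∘prev i = toℕ-injective (begin
      toℕ (next (prev i))                  ≡⟨ toℕ-fromℕ< (m%n<n (suc (toℕ (prev i))) n) ⟩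
      suc (toℕ (prev i)) % n               ≡⟨ cong (λ x → suc x % n) (toℕ-fromℕ< (m%n<n (toℕ i + ℓ) n)) ⟩
      suc ((toℕ i + ℓ) % n) % n            ≡⟨ ≋-+ {1} {1} {(toℕ i + ℓ) % n} {toℕ i + ℓ} refl (m%n%n≡m%n (toℕ i + ℓ) n) ⟩
      suc (toℕ i + ℓ) % n                  ≡⟨ suc[x]+ℓ≋x (toℕ i) ⟩
      toℕ i % n                            ≡⟨ m<n⇒m%n≡m (toℕ<n i) ⟩
      toℕ i                                ∎)
      where open ≡-Reasoning

  rotation : Permutation′ n
  rotation = mk↔ₛ′ next prev next∘prev prev∘next

  iter-rotation : ∀ k i → toℕ (iter rotation k i) ≡ (toℕ i + k) % n
  iter-rotation zero i = sym (trans (cong (_% n) (+-identityʳ (toℕ i))) (m<n⇒m%n≡m (toℕ<n i)))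
  iter-rotation (suc k) i = begin
    toℕ (next (iter rotation k i))       ≡⟨ toℕ-fromℕ< (m%n<n (suc (toℕ (iter rotation k i))) n) ⟩
    suc (toℕ (iter rotation k i)) % n    ≡⟨ cong (λ x → suc x % n) (iter-rotation k i) ⟩
    suc ((toℕ i + k) % n) % n            ≡⟨ ≋-+ {1} {1} {(toℕ i + k) % n} {toℕ i + k} refl (m%n%n≡m%n (toℕ i + k) n) ⟩
    suc (toℕ i + k) % n                  ≡⟨ cong (_% n) (sym (+-suc (toℕ i) k)) ⟩
    (toℕ i + suc k) % n                  ∎
    where open ≡-Reasoning

  rotation-cycle-type : CycleType n rotation
  rotation-cycle-type i = toℕ-injective (trans (iter-rotation n i) (trans i+n≋i (m<n⇒m%n≡m (toℕ<n i)))) ,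
    λ k 0<k k<n fixes → <⇒≱ k<n (∣⇒≤ {{>-nonZero 0<k}} (subst (n ∣_) (m+n∸m≡n (toℕ i) k)
      (≋⇒∣∸ (m≤m+n (toℕ i) k) (trans (sym (iter-rotation k i)) (trans (cong toℕ fixes) (sym (m<n⇒m%n≡m (toℕ<n i))))))))
    where
    i+n≋i : (toℕ i + n) % n ≡ toℕ i % n
    i+n≋i = trans (cong (λ x → (toℕ i + x) % n) (sym (*-identityˡ n))) ([m+kn]%n≡m%n (toℕ i) 1 n)

  cycle-type-of-rotation : ∀ {d} → CycleType d rotation → n ∣ d
  cycle-type-of-rotation {d} cycles = m%n≡0⇒n∣m d n (trans (sym (iter-rotation d zero)) (cong toℕ (proj₁ (cycles zero))))

φ-1-positive : ∀ n → 0 < φ 1 (suc n)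
φ-1-positive n = filter-some (λ i → gcd (suc n) i Data.Nat.≟ 1)
  (Any.map (λ { refl → gcd-zeroʳ (suc n) }) (∈-map⁺ suc (∈-upTo⁺ {suc n} {0} z<s)))
  where import Data.Nat

module _ (ℓ p : ℕ) (0<p : 0 < p) where

  private
    n N : ℕ
    n = suc ℓ
    N = p * n
    instance
      p≢0 : NonZero p
      p≢0 = >-nonZero 0<p
      N≢0 : NonZero N
      N≢0 = >-nonZero (*-mono-< 0<p (z<s {ℓ}))

  open Rotation ℓ

  -- The samples lie in the residue class 0 mod p but, when p < n, are not divisible by n.
  sample : ℕ → ℕ
  sample j = p + j * N

  p∣sample : ∀ j → p ∣ sample j
  p∣sample j = ∣m∣n⇒∣m+n (∣-refl) (∣n⇒∣m*n j (m∣m*n n))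

  χ-rotation-sample : p < n → ∀ j → χ ℓ (sample j) rotation ≡ 0
  χ-rotation-sample p<n j = χ-vanishes rotation (sample j) (≤-trans 0<p (m≤m+n p (j * N))) λ (_ , d , _ , d∣sample , cycles) →
    <⇒≱ p<n (∣⇒≤ (∣m+n∣m⇒∣n (subst (n ∣_) (+-comm p (j * N)) (∣-trans (cycle-type-of-rotation cycles) d∣sample))
                             (∣n⇒∣m*n j (n∣m*n p))))

  χ-rotation-N : χ ℓ N rotation ≡ φ 1 n
  χ-rotation-N = ℤ.+-injective (trans (χ-formula rotation N (>-nonZero⁻¹ N) 1 n (*-identityˡ n) (n∣m*n p) rotation-cycle-type)
                                      (ℤ.*-identityʳ (ℤ.+ φ 1 n)))

  no-shorter-period : IsPeriod ℓ p → ¬ p < n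
  no-shorter-period (_ , polynomial) p<n = <⇒≢ (φ-1-positive ℓ) (sym (ℤ.+-injective (toℚ-injective (begin
    toℚ (ℤ.+ φ 1 n)             ≡⟨ cong (toℚ ∘ ℤ.+_) χ-rotation-N ⟨
    toℚ (ℤ.+ χ ℓ N rotation)    ≡⟨ proj₂ (polynomial 0) N (>-nonZero⁻¹ N) (multiple⇒≡0 (m∣m*n n)) rotation ⟩
    evalPoly P N                ≡⟨ vanishing-everywhere P samples samples-unique |P|≤|samples| P-vanishes N ⟩
    0ℚ                          ∎))))
    where
    open ≡-Reasoning
    multiple⇒≡0 : ∀ {x} → p ∣ x → x ≡ 0 [mod p ]
    multiple⇒≡0 p∣x = Mod.≋⇒[mod] p (Mod.∣⇒≋0 p p∣x)
    P : List ℚ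
    P = proj₁ (polynomial 0) rotation
    samples : List ℕ
    samples = map sample (upTo (length P))
    samples-unique : Unique samples
    samples-unique = Unique.map⁺ (λ {i} {j} eq → *-cancelʳ-≡ i j N (+-cancelˡ-≡ p (i * N) (j * N) eq)) (Unique.upTo⁺ (length P))
    |P|≤|samples| : length P ≤ length samples
    |P|≤|samples| = ≤-reflexive (sym (trans (length-map sample (upTo (length P))) (length-upTo (length P))))
    P-vanishes : All (λ r → evalPoly P r ≡ 0ℚ) samples
    P-vanishes = All.tabulate λ r∈samples → vanishes-at (∈-map⁻ sample r∈samples)
      where
      vanishes-at : ∀ {r} → ∃[ j ] (j ∈ upTo (length P) × r ≡ sample j) → evalPoly P r ≡ 0ℚ
      vanishes-at (j , _ , refl) = trans (sym (proj₂ (polynomial 0) (sample j) (≤-trans 0<p (m≤m+n p (j * N))) (multiple⇒≡0 (p∣sample j)) rotation))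
                                         (cong (toℚ ∘ ℤ.+_) (χ-rotation-sample p<n j))

minimal-period : ∀ ℓ p → IsPeriod ℓ p → suc ℓ ≤ p
minimal-period ℓ p period@(0<p , _) = ≮⇒≥ (no-shorter-period ℓ p 0<p period)

open import Data.Integer using (+_) renaming (_*_ to _*ℤ_)

mainTheorem6 : ∀ (ℓ : ℕ) → 1 ≤ ℓ →
  ((σ : Permutation′ (suc ℓ)) → (q : ℕ) → 0 < q →
    ((g d : ℕ) → g * d ≡ suc ℓ → d ∣ q → CycleType d σ →
      + χ ℓ q σ ≡ (+ φ g (suc ℓ)) *ℤ fallProd q d (g ∸ 1))
    × (¬ (∃[ g ] ∃[ d ] (g * d ≡ suc ℓ × d ∣ q × CycleType d σ)) → χ ℓ q σ ≡ 0))
  × (IsPeriod ℓ (suc ℓ) × (∀ (p : ℕ) → IsPeriod ℓ p → suc ℓ ≤ p))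
mainTheorem6 ℓ _ = (λ σ q 0<q → χ-formula σ q 0<q , χ-vanishes σ q 0<q) , period ℓ , minimal-period ℓ
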